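{- Let $D=(G,\mathcal{O},w)$ be a weighted oriented graph and let $K$ be an induced weighted oriented subgraph of $D$. Then the following conditions are equivalent: (1) there is a strong vertex cover $\mathcal{C}$ of $D$ such that $V(K)\subseteq \mathcal{C}$; (2) there is a generating $\star$-semi-forest $H$ of $K$.
   Context: A weighted oriented graph is a triple $D=(G,\mathcal{O},w)$ with $G$ a finite simple graph, $\mathcal{O}$ an orientation of the edges of $G$, and $w:V(G)\to\mathbb{N}$ (positive integers); $V(D)=V(G)$ and $E(D)$ is the set of oriented edges $(x,y)$. $V^{+}=\{x\in V(D)\mid w(x)>1\}$. $N_D^{+}(x)=\{y\mid (x,y)\in E(D)\}$, $N_D^{ - }(x)=\{y\mid (y,x)\in E(D)\}$, $N_D(x)=N_D^+(x)\cup N_D^-(x)$; for $A\subseteq V(D)$, $N_D(A)$ and $N_D^{+}(A)$ are the unions over $a\in A$. A sink is a vertex $x$ with $N_D^+(x)=\emptyset$, a source one with $N_D^-(x)=\emptyset$. Standing convention: every source $x$ has $w(x)=1$. A vertex cover of $D$ is a set $\mathcal{C}\subseteq V(D)$ containing at least one endpoint of every edge. For a vertex cover $\mathcal{C}$: $L_1(\mathcal{C})=\{x\in\mathcal{C}\mid N_D^+(x)\cap (V(D)\setminus\mathcal{C})\neq\emptyset\}$, $L_2(\mathcal{C})=\{x\in\mathcal{C}\setminus L_1(\mathcal{C})\mid N_D^-(x)\cap (V(D)\setminus\mathcal{C})\neq\emptyset\}$, $L_3(\mathcal{C})=\mathcal{C}\setminus(L_1(\mathcal{C})\cup L_2(\mathcal{C}))$.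 $\mathcal{C}$ is strong if for every $x\in L_3(\mathcal{C})$ there is $(y,x)\in E(D)$ with $y\in (\mathcal{C}\setminus L_1(\mathcal{C}))\cap V^{+}$. A weighted oriented subgraph of $D$ is an oriented subgraph of $(G,\mathcal{O})$ with the weights restricted from $w$; it is induced if its underlying graph is an induced subgraph of $G$. For a subgraph $H$, $\deg_H(x)$ is the number of neighbours of $x$ in $H$. An oriented path is a sequence of distinct vertices $(y_1,\dots,y_m)$ with $(y_i,y_{i+1})$ an oriented edge for all $i$; an oriented cycle is $(y_1,\dots,y_m,y_1)$ with $(y_1,\dots,y_m)$ an oriented path and $(y_m,y_1)$ an oriented edge. A unicycle oriented subgraph of $D$ is a weighted oriented subgraph $B$ of $D$ with exactly one cycle $C$ such that: (i) $C$ is an oriented cycle in $B$ and for each $y\in V(B)\setminus V(C)$ there is an oriented path in $B$ from a vertex of $C$ to $y$; (ii) if $x\in V(B)$ and $w(x)=1$ then $\deg_B(x)=1$. A root oriented tree (ROT) with parent $v\in V(T)$ is a weighted oriented subgraph $T$ of $D$ without cycles such that: (i) for each $x\in V(T)\setminus\{v\}$ there is an oriented path in $T$ from $v$ to $x$; (ii) if $x\in V(T)$ and $w(x)=1$, then either ($\deg_T(x)=1$ and $x\neq v$) or ($V(T)=\{v\}$ and $x=v$). A weighted oriented subgraph $H$ of $D$ is a $\star$-semi-forest if there are ROTs $T_1,\dots,T_r$ with parents $v_1,\dots,v_r$ and unicycle oriented subgraphs $B_1,\dots,B_s$ ($r,s\ge 0$) with $H=(\bigcup_i T_i)\cup(\bigcup_j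 B_j)$ such that: (i) $V(T_1),\dots,V(T_r),V(B_1),\dots,V(B_s)$ is a partition of $V(H)$; (ii) there is $W=\{w_1,\dots,w_r\}\subseteq V(D)\setminus V(H)$ with $w_i\in N_D(v_i)$ for each $i$ (possibly $w_i=w_j$ for $i\ne j$); (iii) there is a partition $W_1,W_2$ of $W$ such that $W_1$ is a stable set of $G$, $W_2\subseteq V^{+}$, $(w_i,v_i)\in E(D)$ whenever $w_i\in W_2$, and $N_D^{+}(W_2\cup\tilde H)\cap W_1=\emptyset$, where $\tilde H=\{x\in V(H)\mid \deg_H(x)\ge 2\}\cup\{v_i\mid \deg_H(v_i)=1\}$. For a weighted oriented subgraph $K$ of $D$, a generating $\star$-semi-forest of $K$ is a $\star$-semi-forest $H$ of $D$ with $V(H)=V(K)$. -}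

module Defs where

open import Data.Nat using (ℕ; _≥_; _>_; _≤_)
open import Data.Fin using (Fin)
open import Data.Bool using (Bool; true; false; T; _∧_; _∨_)
open import Data.List using (List; []; _∷_; length; last; head)
open import Data.List.Relation.Unary.Linked using (Linked)
open import Data.List.Relation.Unary.Unique.Propositional using (Unique)
open import Data.List.Membership.Propositional using (_∈_; _∉_)
open import Data.Maybe using (just)
open import Data.Product using (Σ; _×_; _,_)
open import Data.Sum using (_⊎_)
open import Data.Empty using (⊥)
open import Relation.Nullary using (¬_)
open import Relation.Binary.PropositionalEquality using (_≡_; _≢_)
open import Data.Vec using (tabulate)
open import Data.Fin.Subset using (∣_∣)

_↔_ : Set → Set → Set
A ↔ B = (A → B) × (B → A)
infix 3 _↔_

-- The underlying simple graph G has edge {x,y} iff E x y or E y x;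
-- the orientation picks exactly one direction (asym), no loops (irrefl).
record WOG : Set where
  field
    n        : ℕ
    E        : Fin n → Fin n → Bool
    w        : Fin n → ℕ
    irrefl   : ∀ x → E x x ≡ false
    asym     : ∀ x y → T (E x y) → ¬ T (E y x)
    w-pos    : ∀ x → w x ≥ 1
    -- standing convention: every source has weight 1
    source-w : ∀ x → (∀ y → E y x ≡ false) → w x ≡ 1

-- A (candidate) weighted oriented subgraph: vertex set and oriented edge set.
-- Weights are always the restriction of w, so they are not stored.
record Sub (n : ℕ) : Set where
  field
    V  : Fin n → Bool
    Ed : Fin n → Fin n → Bool
open Sub public

module _ {n : ℕ} where

  adj : Sub n → Fin n → Fin n → Bool
  adj H x y = Ed H x y ∨ Ed H y x

  deg : Sub n → Fin n → ℕ
  deg H x = ∣ tabulate (adj H x) ∣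

  OPath : Sub n → Fin n → Fin n → Set
  OPath H a b = Σ (List (Fin n)) λ xs →
    Unique (a ∷ xs) × Linked (λ x y → T (Ed H x y)) (a ∷ xs) × last (a ∷ xs) ≡ just b

  OCycle : Sub n → List (Fin n) → Set
  OCycle H ys = Unique ys × Linked (λ x y → T (Ed H x y)) ys ×
    Σ (Fin n) λ y → Σ (Fin n) λ z → head ys ≡ just y × last ys ≡ just z × T (Ed H z y)

  UCycle : Sub n → List (Fin n) → Set
  UCycle H ys = Unique ys × 3 ≤ length ys × Linked (λ x y → T (adj H x y)) ys ×
    Σ (Fin n) λ y → Σ (Fin n) λ z → head ys ≡ just y × last ys ≡ just z × T (adj H z y)

  consec : List (Fin n) → Fin n → Fin n → Set
  consec []           a b = ⊥
  consec (x ∷ [])     a b = ⊥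
  consec (x ∷ y ∷ r)  a b = (a ≡ x × b ≡ y) ⊎ consec (y ∷ r) a b

  cycEdge : List (Fin n) → Fin n → Fin n → Set
  cycEdge ys a b = (consec ys a b ⊎ (last ys ≡ just a × head ys ≡ just b))
                 ⊎ (consec ys b a ⊎ (last ys ≡ just b × head ys ≡ just a))

module WithD (D : WOG) where
  open WOG D

  adjD : Fin n → Fin n → Bool
  adjD x y = E x y ∨ E y x

  IsSub : Sub n → Set
  IsSub H = ∀ x y → T (Ed H x y) → T (E x y) × T (V H x) × T (V H y)

  Induced : Sub n → Set
  Induced K = ∀ x y → Ed K x y ≡ (V K x ∧ V K y ∧ E x y)

  VertexCover : (Fin n → Bool) → Set
  VertexCover C = ∀ x y → T (E x y) → T (C x ∨ C y)

  L₁ : (Fin n → Bool) → Fin n → Set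
  L₁ C x = T (C x) × Σ (Fin n) λ y → T (E x y) × C y ≡ false

  L₂ : (Fin n → Bool) → Fin n → Set
  L₂ C x = T (C x) × ¬ L₁ C x × Σ (Fin n) λ y → T (E y x) × C y ≡ false

  L₃ : (Fin n → Bool) → Fin n → Set
  L₃ C x = T (C x) × ¬ L₁ C x × ¬ L₂ C x

  StrongVC : (Fin n → Bool) → Set
  StrongVC C = VertexCover C ×
    (∀ x → L₃ C x → Σ (Fin n) λ y → T (E y x) × T (C y) × ¬ L₁ C y × w y > 1)

  Unicycle : Sub n → Set
  Unicycle B = IsSub B ×
    Σ (List (Fin n)) λ ys →
      OCycle B ys ×
      -- C is the only cycle of B
      (∀ zs → UCycle B zs → ∀ a b → cycEdge zs a b ↔ cycEdge ys a b) ×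
      (∀ y → T (V B y) → y ∉ ys → Σ (Fin n) λ c → c ∈ ys × OPath B c y) ×
      (∀ x → T (V B x) → w x ≡ 1 → deg B x ≡ 1)

  ROT : Sub n → Fin n → Set
  ROT Tr v = IsSub Tr × T (V Tr v) ×
    (∀ zs → ¬ UCycle Tr zs) ×
    (∀ x → T (V Tr x) → x ≢ v → OPath Tr v x) ×
    (∀ x → T (V Tr x) → w x ≡ 1 →
       (deg Tr x ≡ 1 × x ≢ v) ⊎ ((∀ y → T (V Tr y) → y ≡ v) × x ≡ v))

  StarSemiForest : Sub n → Set
  StarSemiForest H = IsSub H ×
    Σ ℕ λ r → Σ ℕ λ s →
    Σ (Fin r → Sub n) λ Tr → Σ (Fin r → Fin n) λ v → Σ (Fin s → Sub n) λ B →
      (∀ i → ROT (Tr i) (v i)) × (∀ j → Unicycle (B j)) ×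
      (∀ x → T (V H x) ↔ ((Σ (Fin r) λ i → T (V (Tr i) x)) ⊎ (Σ (Fin s) λ j → T (V (B j) x)))) ×
      (∀ x y → T (Ed H x y) ↔
         ((Σ (Fin r) λ i → T (Ed (Tr i) x y)) ⊎ (Σ (Fin s) λ j → T (Ed (B j) x y)))) ×
      (∀ i i' x → T (V (Tr i) x) → T (V (Tr i') x) → i ≡ i') ×
      (∀ j j' x → T (V (B j) x) → T (V (B j') x) → j ≡ j') ×
      (∀ i j x → T (V (Tr i) x) → ¬ T (V (B j) x)) ×
      -- (ii), (iii): W = {wᵥ i}, W₂ = {wᵥ i | inW₂ (wᵥ i)}, W₁ = W ∖ W₂
      Σ (Fin r → Fin n) λ wᵥ → Σ (Fin n → Bool) λ inW₂ →
        (∀ i → ¬ T (V H (wᵥ i))) ×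
        (∀ i → T (adjD (wᵥ i) (v i))) ×
        (∀ i j → inW₂ (wᵥ i) ≡ false → inW₂ (wᵥ j) ≡ false → ¬ T (adjD (wᵥ i) (wᵥ j))) ×
        (∀ i → T (inW₂ (wᵥ i)) → w (wᵥ i) > 1) ×
        (∀ i → T (inW₂ (wᵥ i)) → T (E (wᵥ i) (v i))) ×
        (∀ a i →
           ((Σ (Fin r) λ j → a ≡ wᵥ j × T (inW₂ (wᵥ j)))
            ⊎ ((T (V H a) × deg H a ≥ 2) ⊎ (Σ (Fin r) λ j → a ≡ v j × deg H (v j) ≡ 1))) →
           inW₂ (wᵥ i) ≡ false → ¬ T (E a (wᵥ i)))

-- (1) ⇒ (2): let each vertex x of K choose as parent some y ∈ V(K) ∩ (C ∖ L₁) ∩ V⁺ with (y , x) ∈ E(D),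
-- when there is one. Following parents, every vertex runs into a cycle or into a parentless root; grouping
-- the vertices of K by that cycle (named by its least vertex) or root cuts K into unicycle oriented subgraphs
-- and ROTs. A root ρ ∈ C has a neighbour outside C, which goes into W₁, or lies in L₃, where strongness
-- supplies an in-neighbour in (C ∖ L₁) ∩ V⁺ outside K, which goes into W₂.
-- (2) ⇒ (1): V(K) and the out-neighbours of W₂ and of the tails of arcs of H have to be covered. Extend the
-- stable set W₁ to a stable set S avoiding them that is maximal among such sets, and let C be its complement.
-- A vertex of L₃(C) is then either the head of an arc from a tail, which lies in (C ∖ L₁) ∩ V⁺, or a root vᵢ
-- whose wᵢ ∈ W₁ ⊆ S would put it in L₁ ∪ L₂.

module Submission where

open import Defs
open import Data.Bool using (Bool; true; false; T; _∧_; _∨_; not)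
open import Data.Bool.Properties using (T-∨; T-∧) renaming (_≟_ to _≟ᵇ_)
open import Data.Empty using (⊥; ⊥-elim)
open import Data.Fin using (Fin; zero; suc; toℕ; fromℕ<)
open import Data.Fin.Properties using (any?; suc-injective; 0≢1+n; toℕ-fromℕ<; toℕ-injective; toℕ<n; pigeonhole)
  renaming (_≟_ to _≟ᶠ_)
open import Data.Fin.Subset using (∣_∣)
open import Data.List using (List; []; _∷_; _++_; last; head; length; lookup; filter; allFin; applyDownFrom)
open import Data.List.Extrema.Nat using (argmax; argmax-all; f[xs]≤f[argmax])
open import Data.List.Membership.Propositional using (_∈_; _∉_)
open import Data.List.Membership.Propositional.Properties
  using (∈-∃++; ∈-allFin; ∈-filter⁺; ∈-filter⁻; ∈-lookup; ∈-applyDownFrom⁺; ∈-applyDownFrom⁻)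
open import Data.List.Properties using (length-++; ++-identityʳ)
import Data.List.Relation.Binary.Permutation.Setoid.Properties as PermutationProperties
import Data.List.Relation.Unary.All as All
open import Data.List.Relation.Unary.AllPairs using ([]; _∷_)
open import Data.List.Relation.Unary.AllPairs.Properties using (applyDownFrom⁺₁)
open import Data.List.Relation.Unary.Any using (here; there; index)
open import Data.List.Relation.Unary.Any.Properties using (lookup-index)
open import Data.List.Relation.Unary.Linked using (Linked; []; [-]; _∷_)
open import Data.List.Relation.Unary.Unique.Propositional using (Unique)
import Data.List.Relation.Unary.Unique.Propositional.Properties as Unique
open import Data.Maybe using (just)
open import Data.Maybe.Properties using (just-injective)
open import Data.Nat using (ℕ; zero; suc; _+_; _*_; _∸_; _≤_; _<_; _>_; _≥_; z≤n; s≤s; _%_; _/_; NonZero)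
import Data.Nat.Properties as ℕ
open import Data.Nat.DivMod using (m≡m%n+[m/n]*n; m%n<n)
open import Data.Product using (Σ; _×_; _,_; proj₁; proj₂)
open import Data.Sum using (_⊎_; inj₁; inj₂; [_,_])
open import Data.Vec using (tabulate)
open import Function using (_∘_; flip)
open import Function.Bundles using (Equivalence)
open import Relation.Binary.PropositionalEquality
  using (_≡_; _≢_; refl; sym; trans; cong; subst; subst₂; setoid; module ≡-Reasoning)
open import Relation.Nullary using (¬_; Dec; yes; no)
open import Relation.Nullary.Decidable using (T?; _×-dec_; _⊎-dec_; ¬?; isYes; toWitness; fromWitness)

private
  variable
    A : Set
    m : ℕ

T-∨ˡ : ∀ {a b} → T a → T (a ∨ b)
T-∨ˡ {a} {b} t = Equivalence.from (T-∨ {a} {b}) (inj₁ t)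

T-∨ʳ : ∀ {a b} → T b → T (a ∨ b)
T-∨ʳ {a} {b} t = Equivalence.from (T-∨ {a} {b}) (inj₂ t)

T-∨⁻ : ∀ {a b} → T (a ∨ b) → T a ⊎ T b
T-∨⁻ {a} {b} = Equivalence.to (T-∨ {a} {b})

T-∧⁺ : ∀ {a b} → T a → T b → T (a ∧ b)
T-∧⁺ {a} {b} ta tb = Equivalence.from (T-∧ {a} {b}) (ta , tb)

T-∧⁻ : ∀ {a b} → T (a ∧ b) → T a × T b
T-∧⁻ {a} {b} = Equivalence.to (T-∧ {a} {b})

T-not⁺ : ∀ {a} → ¬ T a → T (not a)
T-not⁺ {false} _ = _
T-not⁺ {true} ¬t = ¬t _

T-not⁻ : ∀ {a} → T (not a) → ¬ T a
T-not⁻ {false} _ ()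

∣tabulate∣≡0 : (f : Fin m → Bool) → (∀ y → ¬ T (f y)) → ∣ tabulate f ∣ ≡ 0
∣tabulate∣≡0 {zero} f none = refl
∣tabulate∣≡0 {suc m} f none with f zero in eq
... | true = ⊥-elim (none zero (subst T (sym eq) _))
... | false = ∣tabulate∣≡0 (f ∘ suc) (none ∘ suc)

∣tabulate∣≤1 : (f : Fin m → Bool) → (∀ y z → T (f y) → T (f z) → y ≡ z) → ∣ tabulate f ∣ ≤ 1
∣tabulate∣≤1 {zero} f unique = z≤n
∣tabulate∣≤1 {suc m} f unique with f zero in eq
... | true rewrite ∣tabulate∣≡0 (f ∘ suc) (λ y t → 0≢1+n (unique zero (suc y) (subst T (sym eq) _) t)) = s≤s z≤n
... | false = ∣tabulate∣≤1 (f ∘ suc) (λ y z ty tz → suc-injective (unique (suc y) (suc z) ty tz))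

1≤∣tabulate∣ : (f : Fin m → Bool) (a : Fin m) → T (f a) → 1 ≤ ∣ tabulate f ∣
1≤∣tabulate∣ {suc m} f a t with f zero in eq
... | true = s≤s z≤n
1≤∣tabulate∣ {suc m} f zero t | false = ⊥-elim (subst T eq t)
1≤∣tabulate∣ {suc m} f (suc a) t | false = 1≤∣tabulate∣ (f ∘ suc) a t

2≤∣tabulate∣ : (f : Fin m → Bool) (a b : Fin m) → a ≢ b → T (f a) → T (f b) → 2 ≤ ∣ tabulate f ∣
2≤∣tabulate∣ {suc m} f zero zero a≢b _ _ = ⊥-elim (a≢b refl)
2≤∣tabulate∣ {suc m} f zero (suc b) a≢b ta tb with f zero
... | true = s≤s (1≤∣tabulate∣ (f ∘ suc) b tb)
2≤∣tabulate∣ {suc m} f (suc a) zero a≢b ta tb with f zero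
... | true = s≤s (1≤∣tabulate∣ (f ∘ suc) a ta)
2≤∣tabulate∣ {suc m} f (suc a) (suc b) a≢b ta tb with f zero
... | true = ℕ.m≤n⇒m≤1+n (2≤∣tabulate∣ (f ∘ suc) a b (a≢b ∘ cong suc) ta tb)
... | false = 2≤∣tabulate∣ (f ∘ suc) a b (a≢b ∘ cong suc) ta tb

Unique-++-comm : (xs ys : List A) → Unique (xs ++ ys) → Unique (ys ++ xs)
Unique-++-comm {A} xs ys = Unique-resp-↭ (++-comm xs ys)
  where open PermutationProperties (setoid A)

last-++ : (xs : List A) (y : A) (ys : List A) → last (xs ++ y ∷ ys) ≡ last (y ∷ ys)
last-++ [] y ys = refl
last-++ (x ∷ []) y ys = refl
last-++ (x ∷ x' ∷ xs) y ys = last-++ (x' ∷ xs) y ys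

last-∈ : (xs : List A) {z : A} → last xs ≡ just z → z ∈ xs
last-∈ (x ∷ []) e = here (sym (just-injective e))
last-∈ (x ∷ y ∷ xs) e = there (last-∈ (y ∷ xs) e)

head-∈ : (xs : List A) {z : A} → head xs ≡ just z → z ∈ xs
head-∈ (x ∷ xs) refl = here refl

last-exists : (x : A) (xs : List A) → Σ A λ z → last (x ∷ xs) ≡ just z
last-exists x [] = x , refl
last-exists x (y ∷ xs) = last-exists y xs

Linked-last : ∀ {R : A → A → Set} a x xs b →
  Linked R (a ∷ x ∷ xs) → last (x ∷ xs) ≡ just b → Σ A λ z → R z b
Linked-last {R = R} a x [] b (r ∷ _) eq = a , subst (R a) (just-injective eq) r
Linked-last a x (y ∷ xs) b (_ ∷ lk) eq = Linked-last x y xs b lk eq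

Linked-∈ : ∀ {R : A → A → Set} a xs x → Linked R (a ∷ xs) → x ∈ xs → Σ A λ z → R z x
Linked-∈ a (b ∷ xs) x (r ∷ lk) (here refl) = a , r
Linked-∈ a (b ∷ xs) x (r ∷ lk) (there m) = Linked-∈ b xs x lk m

Unique-lookup-injective : (L : List A) → Unique L → ∀ i j → lookup L i ≡ lookup L j → i ≡ j
Unique-lookup-injective (x ∷ L) u zero zero e = refl
Unique-lookup-injective (x ∷ L) (x∉ ∷ u) zero (suc j) e = ⊥-elim (All.lookup x∉ (∈-lookup j) e)
Unique-lookup-injective (x ∷ L) (x∉ ∷ u) (suc i) zero e = ⊥-elim (All.lookup x∉ (∈-lookup i) (sym e))
Unique-lookup-injective (x ∷ L) (_ ∷ u) (suc i) (suc j) e = cong suc (Unique-lookup-injective L u i j e)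

position : (L : List A) (c : A) → c ∈ L → Σ (Fin (length L)) λ i → lookup L i ≡ c
position L c c∈ = index c∈ , sym (lookup-index c∈)

CycArc : List (Fin m) → Fin m → Fin m → Set
CycArc L a b = consec L a b ⊎ (last L ≡ just a × head L ≡ just b)

ClosingArc : (Fin m → Fin m → Set) → List (Fin m) → Set
ClosingArc {m} R L = Σ (Fin m) λ y → Σ (Fin m) λ z → head L ≡ just y × last L ≡ just z × R z y

consec-++⁻ : (xs ys : List (Fin m)) (a b : Fin m) → consec (xs ++ ys) a b →
  consec xs a b ⊎ consec ys a b ⊎ (last xs ≡ just a × head ys ≡ just b)
consec-++⁻ [] ys a b c = inj₂ (inj₁ c)
consec-++⁻ (x ∷ []) (y ∷ ys) a b (inj₁ (refl , refl)) = inj₂ (inj₂ (refl , refl))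
consec-++⁻ (x ∷ []) (y ∷ ys) a b (inj₂ c) = inj₂ (inj₁ c)
consec-++⁻ (x ∷ x' ∷ xs) ys a b (inj₁ e) = inj₁ (inj₁ e)
consec-++⁻ (x ∷ x' ∷ xs) ys a b (inj₂ c) with consec-++⁻ (x' ∷ xs) ys a b c
... | inj₁ c' = inj₁ (inj₂ c')
... | inj₂ r = inj₂ r

consec-++⁺ˡ : (xs ys : List (Fin m)) (a b : Fin m) → consec xs a b → consec (xs ++ ys) a b
consec-++⁺ˡ (x ∷ x' ∷ xs) ys a b (inj₁ e) = inj₁ e
consec-++⁺ˡ (x ∷ x' ∷ xs) ys a b (inj₂ c) = inj₂ (consec-++⁺ˡ (x' ∷ xs) ys a b c)

consec-++⁺ʳ : (xs ys : List (Fin m)) (a b : Fin m) → consec ys a b → consec (xs ++ ys) a b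
consec-++⁺ʳ [] ys a b c = c
consec-++⁺ʳ (x ∷ []) (y ∷ y' ∷ ys) a b c = inj₂ c
consec-++⁺ʳ (x ∷ x' ∷ xs) ys a b c = inj₂ (consec-++⁺ʳ (x' ∷ xs) ys a b c)

consec-++⁺-join : (xs ys : List (Fin m)) (a b : Fin m) →
  last xs ≡ just a → head ys ≡ just b → consec (xs ++ ys) a b
consec-++⁺-join (x ∷ []) (y ∷ ys) a b refl refl = inj₁ (refl , refl)
consec-++⁺-join (x ∷ x' ∷ xs) ys a b l h = inj₂ (consec-++⁺-join (x' ∷ xs) ys a b l h)

CycArc-rotate : (x : Fin m) (xs : List (Fin m)) (y : Fin m) (ys : List (Fin m)) (a b : Fin m) →
  CycArc ((x ∷ xs) ++ (y ∷ ys)) a b → CycArc ((y ∷ ys) ++ (x ∷ xs)) a b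
CycArc-rotate x xs y ys a b (inj₁ c) with consec-++⁻ (x ∷ xs) (y ∷ ys) a b c
... | inj₁ c₁ = inj₁ (consec-++⁺ʳ (y ∷ ys) (x ∷ xs) a b c₁)
... | inj₂ (inj₁ c₂) = inj₁ (consec-++⁺ˡ (y ∷ ys) (x ∷ xs) a b c₂)
... | inj₂ (inj₂ (l , h)) = inj₂ (trans (last-++ (y ∷ ys) x xs) l , h)
CycArc-rotate x xs y ys a b (inj₂ (l , h)) =
  inj₁ (consec-++⁺-join (y ∷ ys) (x ∷ xs) a b (trans (sym (last-++ (x ∷ xs) y ys)) l) h)

cycEdge-rotate : (xs ys : List (Fin m)) (a b : Fin m) → cycEdge (xs ++ ys) a b → cycEdge (ys ++ xs) a b
cycEdge-rotate [] ys a b c rewrite ++-identityʳ ys = c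
cycEdge-rotate (x ∷ xs) [] a b c rewrite ++-identityʳ (x ∷ xs) = c
cycEdge-rotate (x ∷ xs) (y ∷ ys) a b (inj₁ c) = inj₁ (CycArc-rotate x xs y ys a b c)
cycEdge-rotate (x ∷ xs) (y ∷ ys) a b (inj₂ c) = inj₂ (CycArc-rotate x xs y ys b a c)

cycEdge-sym : (L : List (Fin m)) (a b : Fin m) → cycEdge L a b → cycEdge L b a
cycEdge-sym L a b (inj₁ c) = inj₂ c
cycEdge-sym L a b (inj₂ c) = inj₁ c

-- Rotating the cycle so that x comes first, its neighbours are the second and the last vertex.
cycEdge-neighbours : (zs : List (Fin m)) (x : Fin m) → Unique zs → 3 ≤ length zs → x ∈ zs →
  Σ (Fin m) λ l → Σ (Fin m) λ r → l ≢ r × cycEdge zs x l × cycEdge zs x r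
cycEdge-neighbours {m} zs x u len x∈zs with ∈-∃++ x∈zs
... | pre , post , refl with rotated (post ++ pre) (Unique-++-comm pre (x ∷ post) u) len'
  where
  len' : 3 ≤ suc (length (post ++ pre))
  len' = subst (3 ≤_) (trans (length-++ pre) (trans (ℕ.+-comm (length pre) _) (sym (length-++ (x ∷ post))))) len
  rotated : ∀ tl → Unique (x ∷ tl) → 3 ≤ length (x ∷ tl) →
    Σ (Fin m) λ l → Σ (Fin m) λ r → l ≢ r × cycEdge (x ∷ tl) x l × cycEdge (x ∷ tl) x r
  rotated [] _ (s≤s ())
  rotated (_ ∷ []) _ (s≤s (s≤s ()))
  rotated (y₁ ∷ y₂ ∷ rest) (_ ∷ y₁∉ ∷ _) _ with last-exists y₂ rest
  ... | z , lz = y₁ , z , (λ e → All.lookup y₁∉ (subst (_∈ y₂ ∷ rest) (sym e) (last-∈ (y₂ ∷ rest) lz)) refl)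
               , inj₁ (inj₁ (inj₁ (refl , refl))) , inj₂ (inj₂ (lz , refl))
... | l , r , l≢r , el , er =
  l , r , l≢r , cycEdge-rotate (x ∷ post) pre x l el , cycEdge-rotate (x ∷ post) pre x r er

consec-Linked : ∀ {R : Fin m → Fin m → Set} (L : List (Fin m)) a b → Linked R L → consec L a b → R a b
consec-Linked (x ∷ y ∷ L) a b (r ∷ lk) (inj₁ (refl , refl)) = r
consec-Linked (x ∷ y ∷ L) a b (r ∷ lk) (inj₂ c) = consec-Linked (y ∷ L) a b lk c

CycArc-Linked : ∀ {R : Fin m → Fin m → Set} (L : List (Fin m)) a b →
  Linked R L → ClosingArc R L → CycArc L a b → R a b
CycArc-Linked L a b lk cl (inj₁ c) = consec-Linked L a b lk c
CycArc-Linked {R = R} L a b lk (y , z , h , l , r) (inj₂ (l' , h')) =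
  subst₂ R (just-injective (trans (sym l) l')) (just-injective (trans (sym h) h')) r

cycEdge-Linked : ∀ {R : Fin m → Fin m → Set} (L : List (Fin m)) a b →
  Linked R L → ClosingArc R L → cycEdge L a b → R a b ⊎ R b a
cycEdge-Linked L a b lk cl (inj₁ c) = inj₁ (CycArc-Linked L a b lk cl c)
cycEdge-Linked L a b lk cl (inj₂ c) = inj₂ (CycArc-Linked L b a lk cl c)

consec-∈ : (L : List (Fin m)) (a b : Fin m) → consec L a b → a ∈ L × b ∈ L
consec-∈ (x ∷ y ∷ L) a b (inj₁ (refl , refl)) = here refl , there (here refl)
consec-∈ (x ∷ y ∷ L) a b (inj₂ c) with consec-∈ (y ∷ L) a b c
... | a∈ , b∈ = there a∈ , there b∈

CycArc-∈ : (L : List (Fin m)) (a b : Fin m) → CycArc L a b → a ∈ L × b ∈ L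
CycArc-∈ L a b (inj₁ c) = consec-∈ L a b c
CycArc-∈ L a b (inj₂ (l , h)) = last-∈ L l , head-∈ L h

cycEdge-∈ʳ : (L : List (Fin m)) (a b : Fin m) → cycEdge L a b → b ∈ L
cycEdge-∈ʳ L a b (inj₁ c) = proj₂ (CycArc-∈ L a b c)
cycEdge-∈ʳ L a b (inj₂ c) = proj₁ (CycArc-∈ L b a c)

-- Iterating a map on a finite set

Fin-least : (P : Fin m → Set) → (∀ x → Dec (P x)) → Σ (Fin m) P →
  Σ (Fin m) λ c → P c × (∀ c' → P c' → toℕ c ≤ toℕ c')
Fin-least {suc m} P P? witness with P? zero
... | yes p₀ = zero , p₀ , λ _ _ → z≤n
... | no ¬p₀ with witness
... | zero , p = ⊥-elim (¬p₀ p)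
... | suc c , p with Fin-least (P ∘ suc) (P? ∘ suc) (c , p)
... | c' , pc' , least = suc c' , pc' , λ { zero p₀ → ⊥-elim (¬p₀ p₀) ; (suc d) pd → s≤s (least d pd) }

Fin-nonempty : Fin m → Σ ℕ λ k → m ≡ suc k
Fin-nonempty {suc k} _ = k , refl

Fin-zero : Fin m → Σ (Fin m) λ k → toℕ k ≡ 0
Fin-zero {suc m} _ = zero , refl

module ParentMap (n : ℕ) (par : Fin n → Fin n) where

  iter : ℕ → Fin n → Fin n
  iter zero x = x
  iter (suc k) x = iter k (par x)

  iter-par : ∀ k x → iter k (par x) ≡ par (iter k x)
  iter-par zero x = refl
  iter-par (suc k) x = iter-par k (par x)

  iter-+ : ∀ a b x → iter (a + b) x ≡ iter b (iter a x)
  iter-+ zero b x = refl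
  iter-+ (suc a) b x = iter-+ a b (par x)

  iter-comm : ∀ a b x → iter a (iter b x) ≡ iter b (iter a x)
  iter-comm a b x = trans (sym (iter-+ b a x)) (trans (cong (flip iter x) (ℕ.+-comm b a)) (iter-+ a b x))

  iter-fixed : ∀ k x → par x ≡ x → iter k x ≡ x
  iter-fixed zero x e = refl
  iter-fixed (suc k) x e = trans (cong (iter k) e) (iter-fixed k x e)

  iter-* : ∀ p q u → iter p u ≡ u → iter (q * p) u ≡ u
  iter-* p zero u e = refl
  iter-* p (suc q) u e = trans (iter-+ p (q * p) u) (trans (cong (iter (q * p)) e) (iter-* p q u e))

  iter-% : ∀ p m u → .{{_ : NonZero p}} → iter p u ≡ u → iter m u ≡ iter (m % p) u
  iter-% p m u e = begin
    iter m u                               ≡⟨ cong (flip iter u) (m≡m%n+[m/n]*n m p) ⟩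
    iter (m % p + m / p * p) u             ≡⟨ trans (cong (flip iter u) (ℕ.+-comm (m % p) _)) (iter-+ (m / p * p) (m % p) u) ⟩
    iter (m % p) (iter (m / p * p) u)      ≡⟨ cong (iter (m % p)) (iter-* p (m / p) u e) ⟩
    iter (m % p) u                         ∎
    where open ≡-Reasoning

  -- Periods are bounded by n, so a period is recorded as an element of Fin n; this makes Periodic decidable.
  Periodic : Fin n → Set
  Periodic z = Σ (Fin n) λ k → iter (suc (toℕ k)) z ≡ z

  periodic? : ∀ z → Dec (Periodic z)
  periodic? z = any? (λ k → iter (suc (toℕ k)) z ≟ᶠ z)

  Periodic-period : ∀ q z → q < n → iter (suc q) z ≡ z → Periodic z
  Periodic-period q z q<n e = fromℕ< q<n , subst (λ m → iter (suc m) z ≡ z) (sym (toℕ-fromℕ< q<n)) e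

  Periodic-iter : ∀ j z → Periodic z → Periodic (iter j z)
  Periodic-iter j z (k , e) = k , trans (iter-comm (suc (toℕ k)) j z) (cong (iter j) e)

  Periodic-par : ∀ z → Periodic z → Periodic (par z)
  Periodic-par = Periodic-iter 1

  fixed⇒Periodic : ∀ z → par z ≡ z → Periodic z
  fixed⇒Periodic z e = Periodic-period 0 z (ℕ.≤-trans (s≤s z≤n) (toℕ<n z)) e

  -- Two of x, par x, …, parⁿ x coincide (pigeonhole), so parⁿ x lies on a cycle.
  Periodic-iterₙ : ∀ x → Periodic (iter n x)
  Periodic-iterₙ x with pigeonhole (ℕ.n<1+n n) (λ (i : Fin (suc n)) → iter (toℕ i) x)
  ... | i , j , i<j , same with ℕ.m≤n⇒∃[o]m+o≡n i<j
  ... | d , i+1+d≡j = subst Periodic reach (Periodic-iter (n ∸ toℕ i) _ periodic)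
    where
    j≤n : toℕ j ≤ n
    j≤n = ℕ.≤-pred (toℕ<n j)
    d<n : d < n
    d<n = ℕ.≤-trans (s≤s (ℕ.m≤n+m d (toℕ i))) (ℕ.≤-trans (ℕ.≤-reflexive i+1+d≡j) j≤n)
    periodic : Periodic (iter (toℕ i) x)
    periodic = Periodic-period d _ d<n (begin
      iter (suc d) (iter (toℕ i) x)  ≡⟨ sym (iter-+ (toℕ i) (suc d) x) ⟩
      iter (toℕ i + suc d) x         ≡⟨ cong (flip iter x) (trans (ℕ.+-suc (toℕ i) d) i+1+d≡j) ⟩
      iter (toℕ j) x                 ≡⟨ sym same ⟩
      iter (toℕ i) x                 ∎)
      where open ≡-Reasoning
    reach : iter (n ∸ toℕ i) (iter (toℕ i) x) ≡ iter n x
    reach = trans (sym (iter-+ (toℕ i) (n ∸ toℕ i) x))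
                  (cong (flip iter x) (ℕ.m+[n∸m]≡n (ℕ.<⇒≤ (ℕ.<-≤-trans i<j j≤n))))

  depthWithin : ℕ → Fin n → ℕ
  depthWithin zero x = zero
  depthWithin (suc f) x with periodic? x
  ... | yes _ = zero
  ... | no _ = suc (depthWithin f (par x))

  depthWithin-periodic : ∀ f x → Periodic x → depthWithin f x ≡ 0
  depthWithin-periodic zero x c = refl
  depthWithin-periodic (suc f) x c with periodic? x
  ... | yes _ = refl
  ... | no ¬c = ⊥-elim (¬c c)

  depthWithin-suc : ∀ f x → ¬ Periodic x → depthWithin (suc f) x ≡ suc (depthWithin f (par x))
  depthWithin-suc f x ¬c with periodic? x
  ... | yes c = ⊥-elim (¬c c)
  ... | no _ = refl

  depthWithin-reaches : ∀ f x → Periodic (iter f x) → Periodic (iter (depthWithin f x) x)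
  depthWithin-reaches zero x c = c
  depthWithin-reaches (suc f) x c with periodic? x
  ... | yes cx = cx
  ... | no _ = depthWithin-reaches f (par x) c

  depthWithin-minimal : ∀ f x i → i < depthWithin f x → ¬ Periodic (iter i x)
  depthWithin-minimal (suc f) x i i< with periodic? x
  depthWithin-minimal (suc f) x zero i< | no ¬c = ¬c
  depthWithin-minimal (suc f) x (suc i) (s≤s i<) | no ¬c = depthWithin-minimal f (par x) i i<

  depthWithin-≤ : ∀ f x → depthWithin f x ≤ f
  depthWithin-≤ zero x = z≤n
  depthWithin-≤ (suc f) x with periodic? x
  ... | yes _ = z≤n
  ... | no _ = s≤s (depthWithin-≤ f (par x))

  depthWithin-+ : ∀ f g x → Periodic (iter f x) → depthWithin (f + g) x ≡ depthWithin f x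
  depthWithin-+ zero g x c = depthWithin-periodic g x c
  depthWithin-+ (suc f) g x c with periodic? x
  ... | yes _ = refl
  ... | no _ = cong suc (depthWithin-+ f g (par x) c)

  depth : Fin n → ℕ
  depth = depthWithin n

  depth-reaches : ∀ x → Periodic (iter (depth x) x)
  depth-reaches x = depthWithin-reaches n x (Periodic-iterₙ x)

  depth-minimal : ∀ x i → i < depth x → ¬ Periodic (iter i x)
  depth-minimal = depthWithin-minimal n

  depth≤n : ∀ x → depth x ≤ n
  depth≤n = depthWithin-≤ n

  depth-par : ∀ b → ¬ Periodic b → depth b ≡ suc (depth (par b))
  depth-par b ¬c with Fin-nonempty b
  ... | m , n≡1+m = begin
    depthWithin n b                   ≡⟨ cong (flip depthWithin b) n≡1+m ⟩
    depthWithin (suc m) b             ≡⟨ depthWithin-suc m b ¬c ⟩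
    suc (depthWithin m (par b))       ≡⟨ cong suc (sym (depthWithin-+ m 1 (par b) periodic)) ⟩
    suc (depthWithin (m + 1) (par b)) ≡⟨ cong (λ k → suc (depthWithin k (par b))) (trans (ℕ.+-comm m 1) (sym n≡1+m)) ⟩
    suc (depthWithin n (par b))       ∎
    where
    open ≡-Reasoning
    periodic : Periodic (iter m (par b))
    periodic = subst (λ k → Periodic (iter k b)) n≡1+m (Periodic-iterₙ b)

  Orbit : Fin n → Fin n → Set
  Orbit u c = Σ (Fin n) λ j → iter (toℕ j) u ≡ c

  orbit? : ∀ u c → Dec (Orbit u c)
  orbit? u c = any? (λ j → iter (toℕ j) u ≟ᶠ c)

  Orbit-refl : ∀ u → Orbit u u
  Orbit-refl u with Fin-zero u
  ... | k , k≡0 = k , cong (flip iter u) k≡0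

  Orbit-iter : ∀ u → Periodic u → ∀ m → Orbit u (iter m u)
  Orbit-iter u (k , e) m = fromℕ< m%p<n , trans (cong (flip iter u) (toℕ-fromℕ< m%p<n)) (sym (iter-% (suc (toℕ k)) m u e))
    where
    m%p<n : m % suc (toℕ k) < n
    m%p<n = ℕ.<-≤-trans (m%n<n m (suc (toℕ k))) (toℕ<n k)

  Orbit-shift⁻ : ∀ u → Periodic u → ∀ j c → Orbit (iter j u) c → Orbit u c
  Orbit-shift⁻ u pu j c (i , e) = subst (Orbit u) (trans (iter-+ j (toℕ i) u) e) (Orbit-iter u pu (j + toℕ i))

  -- Going once more around the cycle: iter (i + k j) (iter j u) = iter (i + j p) u = iter i u, with period p = k + 1.
  Orbit-shift⁺ : ∀ u → Periodic u → ∀ j c → Orbit u c → Orbit (iter j u) c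
  Orbit-shift⁺ u pu@(k , e) j c (i , eᵢ) = subst (Orbit (iter j u)) back (Orbit-iter (iter j u) (Periodic-iter j u pu) r)
    where
    p r : ℕ
    p = suc (toℕ k)
    r = toℕ i + toℕ k * j
    r+j≡i+j*p : r + j ≡ toℕ i + j * p
    r+j≡i+j*p = trans (ℕ.+-assoc (toℕ i) (toℕ k * j) j)
                      (cong (toℕ i +_) (trans (ℕ.+-comm (toℕ k * j) j) (ℕ.*-comm p j)))
    open ≡-Reasoning
    back : iter r (iter j u) ≡ c
    back = begin
      iter r (iter j u)            ≡⟨ iter-comm r j u ⟩
      iter j (iter r u)            ≡⟨ sym (iter-+ r j u) ⟩
      iter (r + j) u               ≡⟨ cong (flip iter u) r+j≡i+j*p ⟩
      iter (toℕ i + j * p) u       ≡⟨ trans (cong (flip iter u) (ℕ.+-comm (toℕ i) _)) (iter-+ (j * p) (toℕ i) u) ⟩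
      iter (toℕ i) (iter (j * p) u) ≡⟨ cong (iter (toℕ i)) (iter-* p j u e) ⟩
      iter (toℕ i) u               ≡⟨ eᵢ ⟩
      c                            ∎

  Orbit-sym : ∀ u → Periodic u → ∀ c → Orbit u c → Orbit c u
  Orbit-sym u pu c (i , e) = subst (λ q → Orbit q u) e (Orbit-shift⁺ u pu (toℕ i) u (Orbit-refl u))

  Orbit-Periodic : ∀ u → Periodic u → ∀ c → Orbit u c → Periodic c
  Orbit-Periodic u pu c (i , e) = subst Periodic e (Periodic-iter (toℕ i) u pu)

  Orbit-trans : ∀ u → Periodic u → ∀ c d → Orbit u c → Orbit c d → Orbit u d
  Orbit-trans u pu c d (i , e) oc = Orbit-shift⁻ u pu (toℕ i) d (subst (λ q → Orbit q d) (sym e) oc)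

  -- The key of x is the least vertex of the cycle that x eventually runs into. It is opaque because it is
  -- only used through key-Orbit and key-least, and unfolding the search makes type checking far slower.
  opaque
    keyWitness : ∀ x → Σ (Fin n) λ c → Orbit (iter n x) c × (∀ c′ → Orbit (iter n x) c′ → toℕ c ≤ toℕ c′)
    keyWitness x = Fin-least (Orbit (iter n x)) (orbit? (iter n x)) (iter n x , Orbit-refl (iter n x))

    key : Fin n → Fin n
    key x = proj₁ (keyWitness x)

    key-Orbit : ∀ x → Orbit (iter n x) (key x)
    key-Orbit x = proj₁ (proj₂ (keyWitness x))

    key-least : ∀ x c → Orbit (iter n x) c → toℕ (key x) ≤ toℕ c
    key-least x = proj₂ (proj₂ (keyWitness x))

  key-resp : ∀ x y → (∀ c → Orbit (iter n x) c → Orbit (iter n y) c) →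
                     (∀ c → Orbit (iter n y) c → Orbit (iter n x) c) → key x ≡ key y
  key-resp x y x⊆y y⊆x = toℕ-injective (ℕ.≤-antisym (key-least x (key y) (y⊆x _ (key-Orbit y)))
                                                    (key-least y (key x) (x⊆y _ (key-Orbit x))))

  key-par : ∀ b → key (par b) ≡ key b
  key-par b = key-resp (par b) b
    (λ c o → Orbit-shift⁻ (iter n b) (Periodic-iterₙ b) 1 c (subst (λ q → Orbit q c) (iter-par n b) o))
    (λ c o → subst (λ q → Orbit q c) (sym (iter-par n b)) (Orbit-shift⁺ (iter n b) (Periodic-iterₙ b) 1 c o))

  key-iter : ∀ j b → key (iter j b) ≡ key b
  key-iter zero b = refl
  key-iter (suc j) b = trans (key-iter j (par b)) (key-par b)

  Periodic-key : ∀ x → Periodic (key x)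
  Periodic-key x = Orbit-Periodic (iter n x) (Periodic-iterₙ x) (key x) (key-Orbit x)

  Orbit-key : ∀ z → Periodic z → Orbit (key z) z
  Orbit-key z pz = Orbit-sym z pz (key z) (Orbit-shift⁻ z pz n (key z) (key-Orbit z))

  key-idem : ∀ x → key (key x) ≡ key x
  key-idem x with key-Orbit x
  ... | i , e = trans (cong key (sym e)) (trans (key-iter (toℕ i) (iter n x)) (key-iter n x))

  key-fixed : ∀ z → par z ≡ z → key z ≡ z
  key-fixed z e with key-Orbit z
  ... | i , eᵢ = trans (sym eᵢ) (trans (cong (iter (toℕ i)) (iter-fixed n z e)) (iter-fixed (toℕ i) z e))

  trajectory : ℕ → Fin n → List (Fin n)
  trajectory m x = applyDownFrom (flip iter x) m

  trajectory-last : ∀ m x → last (trajectory (suc m) x) ≡ just x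
  trajectory-last zero x = refl
  trajectory-last (suc m) x = trajectory-last m x

  trajectory-Linked : ∀ {R : Fin n → Fin n → Set} m x →
    (∀ i → suc i < m → R (iter (suc i) x) (iter i x)) → Linked R (trajectory m x)
  trajectory-Linked zero x steps = []
  trajectory-Linked (suc zero) x steps = [-]
  trajectory-Linked (suc (suc m)) x steps =
    steps m ℕ.≤-refl ∷ trajectory-Linked (suc m) x (λ i i< → steps i (ℕ.m≤n⇒m≤1+n i<))

  trajectory-Unique : ∀ m x → (∀ i j → j < i → i < m → iter i x ≢ iter j x) → Unique (trajectory m x)
  trajectory-Unique m x distinct = applyDownFrom⁺₁ (flip iter x) m (λ j<i i<m → distinct _ _ j<i i<m)

  trajectory-consec : ∀ m x i → suc i < m → consec (trajectory m x) (iter (suc i) x) (iter i x)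
  trajectory-consec m x i i+1<m with ℕ.m≤n⇒∃[o]m+o≡n i+1<m
  ... | k , refl = subst (λ l → consec (trajectory l x) (iter (suc i) x) (iter i x))
                         (cong (λ q → suc (suc q)) (ℕ.+-comm k i)) (step k)
    where
    step : ∀ k → consec (trajectory (suc (suc (k + i))) x) (iter (suc i) x) (iter i x)
    step zero = inj₁ (refl , refl)
    step (suc k) = inj₂ (step k)

  trajectory-Unique-transient : ∀ x → Unique (trajectory (suc (depth x)) x)
  trajectory-Unique-transient x = trajectory-Unique (suc (depth x)) x distinct
    where
    distinct : ∀ i j → j < i → i < suc (depth x) → iter i x ≢ iter j x
    distinct i j j<i (s≤s i≤d) same with ℕ.m≤n⇒∃[o]m+o≡n j<i
    ... | k , refl = depth-minimal x j (ℕ.<-≤-trans j<i i≤d) (Periodic-period k (iter j x) k<n returns)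
      where
      k<n : k < n
      k<n = ℕ.<-≤-trans (s≤s (ℕ.m≤n+m k j)) (ℕ.≤-trans i≤d (depth≤n x))
      open ≡-Reasoning
      returns : iter (suc k) (iter j x) ≡ iter j x
      returns = begin
        iter (suc k) (iter j x)  ≡⟨ sym (iter-+ j (suc k) x) ⟩
        iter (j + suc k) x       ≡⟨ cong (flip iter x) (ℕ.+-suc j k) ⟩
        iter (suc j + k) x       ≡⟨ same ⟩
        iter j x                 ∎

  trajectory-Unique-cycle : ∀ z (k : Fin n) → iter (suc (toℕ k)) z ≡ z →
    (∀ k′ → iter (suc (toℕ k′)) z ≡ z → toℕ k ≤ toℕ k′) → Unique (trajectory (suc (toℕ k)) z)
  trajectory-Unique-cycle z k period minimal = trajectory-Unique (suc (toℕ k)) z distinct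
    where
    distinct : ∀ i j → j < i → i < suc (toℕ k) → iter i z ≢ iter j z
    distinct i j j<i (s≤s i≤k) same with ℕ.m≤n⇒∃[o]m+o≡n i≤k
    ... | f , i+f≡k = ℕ.<⇒≱ f+j<k (subst (toℕ k ≤_) (toℕ-fromℕ< f+j<n)
                        (minimal (fromℕ< f+j<n) (subst (λ q → iter (suc q) z ≡ z) (sym (toℕ-fromℕ< f+j<n)) returns)))
      where
      f+j<k : f + j < toℕ k
      f+j<k = subst (f + j <_) (trans (ℕ.+-comm f i) i+f≡k) (ℕ.+-monoʳ-< f j<i)
      f+j<n : f + j < n
      f+j<n = ℕ.<-trans f+j<k (toℕ<n k)
      open ≡-Reasoning
      returns : iter (suc (f + j)) z ≡ z
      returns = begin
        iter (suc f + j) z        ≡⟨ cong (flip iter z) (ℕ.+-comm (suc f) j) ⟩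
        iter (j + suc f) z        ≡⟨ iter-+ j (suc f) z ⟩
        iter (suc f) (iter j z)   ≡⟨ cong (iter (suc f)) (sym same) ⟩
        iter (suc f) (iter i z)   ≡⟨ sym (iter-+ i (suc f) z) ⟩
        iter (i + suc f) z        ≡⟨ cong (flip iter z) (trans (ℕ.+-suc i f) (cong suc i+f≡k)) ⟩
        iter (suc (toℕ k)) z      ≡⟨ period ⟩
        z                         ∎

adj-sym : (P : Sub m) (x y : Fin m) → T (adj P x y) → T (adj P y x)
adj-sym P x y t with T-∨⁻ {Ed P x y} t
... | inj₁ e = T-∨ʳ {Ed P y x} e
... | inj₂ e = T-∨ˡ e

2≤deg : (P : Sub m) (y z x : Fin m) → T (Ed P z y) → T (Ed P y x) → z ≢ x → 2 ≤ deg P y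
2≤deg P y z x in-arc out-arc z≢x = 2≤∣tabulate∣ (adj P y) z x z≢x (T-∨ʳ {Ed P y z} in-arc) (T-∨ˡ out-arc)

OPath-last-arc : (P : Sub m) (a b : Fin m) → OPath P a b → a ≢ b → Σ (Fin m) λ z → T (Ed P z b)
OPath-last-arc P a b ([] , _ , _ , e) a≢b = ⊥-elim (a≢b (just-injective e))
OPath-last-arc P a b (x ∷ xs , _ , lk , e) _ = Linked-last a x xs b lk e

OPath-first-arc : (P : Sub m) (a b : Fin m) → OPath P a b → a ≢ b → Σ (Fin m) λ z → T (Ed P a z)
OPath-first-arc P a b ([] , _ , _ , e) a≢b = ⊥-elim (a≢b (just-injective e))
OPath-first-arc P a b (z ∷ xs , _ , r ∷ _ , _) _ = z , r

OCycle-in-arc : (P : Sub m) (ys : List (Fin m)) → OCycle P ys → ∀ x → x ∈ ys → Σ (Fin m) λ z → T (Ed P z x)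
OCycle-in-arc P (y₀ ∷ ys) (_ , _ , y , z , hd , _ , closing) x (here refl) =
  z , subst (λ q → T (Ed P z q)) (sym (just-injective hd)) closing
OCycle-in-arc P (y₀ ∷ ys) (_ , lk , _) x (there x∈ys) = Linked-∈ y₀ ys x lk x∈ys

module _ (D : WOG) where
  open WOG D
  open WithD D
  open import Data.List.Membership.DecPropositional (_≟ᶠ_ {n}) using (_∈?_)

  w>1 : ∀ y → w y ≢ 1 → w y > 1
  w>1 y w≢1 = ℕ.≤∧≢⇒< (w-pos y) (w≢1 ∘ sym)

  IsSub-arcs-distinct : ∀ P z y x → IsSub P → T (Ed P z y) → T (Ed P y x) → z ≢ x
  IsSub-arcs-distinct P z y x isSub zy yx refl = asym y z (proj₁ (isSub y z yx)) (proj₁ (isSub z y zy))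

  ROT-in-arc : ∀ Tr v x → ROT Tr v → T (V Tr x) → x ≢ v → Σ (Fin n) λ z → T (Ed Tr z x)
  ROT-in-arc Tr v x (_ , _ , _ , paths , _) x∈Tr x≢v = OPath-last-arc Tr v x (paths x x∈Tr x≢v) (x≢v ∘ sym)

  Unicycle-in-arc : ∀ B x → Unicycle B → T (V B x) → Σ (Fin n) λ z → T (Ed B z x)
  Unicycle-in-arc B x (_ , ys , cyc , _ , paths , _) x∈B with x ∈? ys
  ... | yes x∈ys = OCycle-in-arc B ys cyc x x∈ys
  ... | no x∉ys with paths x x∈B x∉ys
  ...   | c , c∈ys , path = OPath-last-arc B c x path (λ c≡x → x∉ys (subst (_∈ ys) c≡x c∈ys))

  -- A weight-1 vertex is a non-root leaf, which has an in-arc besides the out-arc, or the root of a one-vertex tree.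
  ROT-tail-heavy : ∀ Tr v y x → ROT Tr v → T (Ed Tr y x) → w y > 1
  ROT-tail-heavy Tr v y x rot@(isSub , _ , _ , _ , light) yx = w>1 y λ w≡1 → leaf (light y y∈Tr w≡1)
    where
    y∈Tr : T (V Tr y)
    y∈Tr = proj₁ (proj₂ (isSub y x yx))
    leaf : (deg Tr y ≡ 1 × y ≢ v) ⊎ ((∀ z → T (V Tr z) → z ≡ v) × y ≡ v) → ⊥
    leaf (inj₁ (deg≡1 , y≢v)) with ROT-in-arc Tr v y rot y∈Tr y≢v
    ... | z , zy = ℕ.<-irrefl (sym deg≡1) (2≤deg Tr y z x zy yx (IsSub-arcs-distinct Tr z y x isSub zy yx))
    leaf (inj₂ (single , refl)) =
      subst T (irrefl y) (subst (T ∘ E y) (single x (proj₂ (proj₂ (isSub y x yx)))) (proj₁ (isSub y x yx)))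

  Unicycle-tail-heavy : ∀ B y x → Unicycle B → T (Ed B y x) → w y > 1
  Unicycle-tail-heavy B y x uni@(isSub , _ , _ , _ , _ , light) yx = w>1 y λ w≡1 →
    let y∈B = proj₁ (proj₂ (isSub y x yx))
        z , zy = Unicycle-in-arc B y uni y∈B
    in ℕ.<-irrefl (sym (light y y∈B w≡1)) (2≤deg B y z x zy yx (IsSub-arcs-distinct B z y x isSub zy yx))

  Stable : (Fin n → Bool) → Set
  Stable S = ∀ x y → T (S x) → T (S y) → ¬ T (E x y)

  Stable-insert : ∀ S x → Stable S → ¬ (Σ (Fin n) λ y → T (S y) × T (adjD x y)) →
                  Stable (λ y → S y ∨ isYes (y ≟ᶠ x))
  Stable-insert S x stable isolated a b a∈ b∈ ab with T-∨⁻ {S a} a∈ | T-∨⁻ {S b} b∈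
  ... | inj₁ a∈S | inj₁ b∈S = stable a b a∈S b∈S ab
  ... | inj₁ a∈S | inj₂ b≡x = isolated (a , a∈S , T-∨ʳ (subst (T ∘ E a) (toWitness b≡x) ab))
  ... | inj₂ a≡x | inj₁ b∈S = isolated (b , b∈S , T-∨ˡ (subst (λ q → T (E q b)) (toWitness a≡x) ab))
  ... | inj₂ a≡x | inj₂ b≡x = subst T (irrefl x) (subst₂ (λ p q → T (E p q)) (toWitness a≡x) (toWitness b≡x) ab)

  Saturates : (Fin n → Set) → (Fin n → Bool) → Fin n → Set
  Saturates F S x = ¬ F x → T (S x) ⊎ Σ (Fin n) λ y → T (S y) × T (adjD x y)

  record StableExtension (F : Fin n → Set) (S₀ : Fin n → Bool) (xs : List (Fin n)) : Set where
    field
      S : Fin n → Bool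
      S₀⊆S : ∀ x → T (S₀ x) → T (S x)
      stable : Stable S
      avoids : ∀ x → T (S x) → ¬ F x
      saturated : ∀ x → x ∈ xs → Saturates F S x

  StableExtension-∷ : ∀ {F S₀ xs} x (ext : StableExtension F S₀ xs) →
    Saturates F (StableExtension.S ext) x → StableExtension F S₀ (x ∷ xs)
  StableExtension-∷ x ext sat-x = record
    { S = S ; S₀⊆S = S₀⊆S ; stable = stable ; avoids = avoids
    ; saturated = λ { y (here refl) → sat-x ; y (there y∈) → saturated y y∈ } }
    where open StableExtension ext

  extendStable : (F : Fin n → Set) → (∀ x → Dec (F x)) → (xs : List (Fin n)) (S₀ : Fin n → Bool) →
    Stable S₀ → (∀ x → T (S₀ x) → ¬ F x) → StableExtension F S₀ xs
  extendStable F F? [] S₀ stable avoids = record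
    { S = S₀ ; S₀⊆S = λ _ t → t ; stable = stable ; avoids = avoids ; saturated = λ _ () }
  extendStable F F? (x ∷ xs) S₀ stable₀ avoids₀ with extendStable F F? xs S₀ stable₀ avoids₀
  ... | ext with F? x | T? (S x) | any? (λ y → T? (S y) ×-dec T? (adjD x y))
    where open StableExtension ext
  ... | yes Fx | _ | _ = StableExtension-∷ x ext (λ ¬Fx → ⊥-elim (¬Fx Fx))
  ... | no _ | yes x∈S | _ = StableExtension-∷ x ext (λ _ → inj₁ x∈S)
  ... | no _ | no _ | yes nbr = StableExtension-∷ x ext (λ _ → inj₂ nbr)
  ... | no ¬Fx | no _ | no isolated = record
    { S = S′
    ; S₀⊆S = λ y t → T-∨ˡ (S₀⊆S y t)
    ; stable = Stable-insert S x stable isolated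
    ; avoids = avoids′
    ; saturated = saturated′
    }
    where
    open StableExtension ext
    S′ : Fin n → Bool
    S′ y = S y ∨ isYes (y ≟ᶠ x)
    avoids′ : ∀ y → T (S′ y) → ¬ F y
    avoids′ y t with T-∨⁻ {S y} t
    ... | inj₁ y∈S = avoids y y∈S
    ... | inj₂ y≡x = subst (¬_ ∘ F) (sym (toWitness y≡x)) ¬Fx
    saturated′ : ∀ y → y ∈ x ∷ xs → Saturates F S′ y
    saturated′ y (here refl) _ = inj₁ (T-∨ʳ {S y} (fromWitness refl))
    saturated′ y (there y∈) ¬Fy with saturated y y∈ ¬Fy
    ... | inj₁ y∈S = inj₁ (T-∨ˡ y∈S)
    ... | inj₂ (z , z∈S , yz) = inj₂ (z , T-∨ˡ z∈S , yz)

-- From a ⋆-semi-forest to a strong vertex cover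

module _ (D : WOG) where
  open WOG D
  open WithD D

  module FromSemiForest (K H : Sub n) (V-H≡V-K : ∀ x → V H x ≡ V K x) (isSub-H : IsSub H)
    {r s : ℕ} (Tr : Fin r → Sub n) (v : Fin r → Fin n) (B : Fin s → Sub n)
    (rot : ∀ i → ROT (Tr i) (v i)) (uni : ∀ j → Unicycle (B j))
    (V-H⇒ : ∀ x → T (V H x) → (Σ (Fin r) λ i → T (V (Tr i) x)) ⊎ (Σ (Fin s) λ j → T (V (B j) x)))
    (Ed-H : ∀ x y → T (Ed H x y) ↔ ((Σ (Fin r) λ i → T (Ed (Tr i) x y)) ⊎ (Σ (Fin s) λ j → T (Ed (B j) x y))))
    (wᵥ : Fin r → Fin n) (inW₂ : Fin n → Bool)
    (W∉H : ∀ i → ¬ T (V H (wᵥ i)))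
    (W-adj : ∀ i → T (adjD (wᵥ i) (v i)))
    (W₁-stable : ∀ i j → inW₂ (wᵥ i) ≡ false → inW₂ (wᵥ j) ≡ false → ¬ T (adjD (wᵥ i) (wᵥ j)))
    (W₂-heavy : ∀ i → T (inW₂ (wᵥ i)) → w (wᵥ i) > 1)
    (W₂-arc : ∀ i → T (inW₂ (wᵥ i)) → T (E (wᵥ i) (v i)))
    (W₁-closed : ∀ a i →
       ((Σ (Fin r) λ j → a ≡ wᵥ j × T (inW₂ (wᵥ j)))
        ⊎ ((T (V H a) × deg H a ≥ 2) ⊎ (Σ (Fin r) λ j → a ≡ v j × deg H (v j) ≡ 1))) →
       inW₂ (wᵥ i) ≡ false → ¬ T (E a (wᵥ i)))
    where

    H̃ : Fin n → Set
    H̃ a = (T (V H a) × deg H a ≥ 2) ⊎ (Σ (Fin r) λ j → a ≡ v j × deg H (v j) ≡ 1)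

    without-in-arc⇒root : ∀ x → T (V H x) → (∀ z → ¬ T (Ed H z x)) → Σ (Fin r) λ i → x ≡ v i
    without-in-arc⇒root x x∈H no-in-arc with V-H⇒ x x∈H
    ... | inj₂ (j , x∈B) with Unicycle-in-arc D (B j) x (uni j) x∈B
    ...   | z , zx = ⊥-elim (no-in-arc z (proj₂ (Ed-H z x) (inj₂ (j , zx))))
    without-in-arc⇒root x x∈H no-in-arc | inj₁ (i , x∈T) with x ≟ᶠ v i
    ...   | yes x≡v = i , x≡v
    ...   | no x≢v with ROT-in-arc D (Tr i) (v i) x (rot i) x∈T x≢v
    ...     | z , zx = ⊥-elim (no-in-arc z (proj₂ (Ed-H z x) (inj₁ (i , zx))))

    tail-heavy : ∀ y x → T (Ed H y x) → w y > 1
    tail-heavy y x yx with proj₁ (Ed-H y x) yx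
    ... | inj₁ (i , yx∈T) = ROT-tail-heavy D (Tr i) (v i) y x (rot i) yx∈T
    ... | inj₂ (j , yx∈B) = Unicycle-tail-heavy D (B j) y x (uni j) yx∈B

    tail∈H : ∀ y x → T (Ed H y x) → T (V H y)
    tail∈H y x yx = proj₁ (proj₂ (isSub-H y x yx))

    tail∈H̃ : ∀ y x → T (Ed H y x) → H̃ y
    tail∈H̃ y x yx with any? (λ z → T? (Ed H z y))
    ... | yes (z , zy) = inj₁ (tail∈H y x yx , 2≤deg H y z x zy yx (IsSub-arcs-distinct D H z y x isSub-H zy yx))
    ... | no no-in-arc with without-in-arc⇒root y (tail∈H y x yx) (λ z zy → no-in-arc (z , zy))
    ...   | j , refl with deg H (v j) in deg≡ | 1≤∣tabulate∣ (adj H (v j)) x (T-∨ˡ yx)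
    ...     | suc zero | _ = inj₂ (j , refl , deg≡)
    ...     | suc (suc _) | _ = inj₁ (tail∈H (v j) x yx , s≤s (s≤s z≤n))

    -- The out-neighbours of tails of arcs of H and of vertices of W₂ have to be covered.
    Tail : Fin n → Set
    Tail y = (Σ (Fin n) λ z → T (Ed H y z)) ⊎ (Σ (Fin r) λ i → y ≡ wᵥ i × T (inW₂ (wᵥ i)))

    tail? : ∀ y → Dec (Tail y)
    tail? y = any? (λ z → T? (Ed H y z)) ⊎-dec any? (λ i → (y ≟ᶠ wᵥ i) ×-dec T? (inW₂ (wᵥ i)))

    FedByTail : Fin n → Set
    FedByTail x = Σ (Fin n) λ y → Tail y × T (E y x)

    fedByTail? : ∀ x → Dec (FedByTail x)
    fedByTail? x = any? (λ y → tail? y ×-dec T? (E y x))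

    Forced : Fin n → Set
    Forced x = T (V K x) ⊎ FedByTail x

    forced? : ∀ x → Dec (Forced x)
    forced? x = T? (V K x) ⊎-dec fedByTail? x

    W₁ : Fin n → Bool
    W₁ u = isYes (any? (λ i → (u ≟ᶠ wᵥ i) ×-dec (inW₂ (wᵥ i) ≟ᵇ false)))

    W₁-Stable : Stable D W₁
    W₁-Stable a b a∈ b∈ ab with toWitness a∈ | toWitness b∈
    ... | i , refl , i∈W₁ | j , refl , j∈W₁ = W₁-stable i j i∈W₁ j∈W₁ (T-∨ˡ ab)

    W₁-unforced : ∀ u → T (W₁ u) → ¬ Forced u
    W₁-unforced u u∈ with toWitness u∈
    ... | i , refl , i∈W₁ = λ
      { (inj₁ u∈K) → W∉H i (subst T (sym (V-H≡V-K (wᵥ i))) u∈K)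
      ; (inj₂ (y , inj₁ (z , yz) , yu)) → W₁-closed y i (inj₂ (tail∈H̃ y z yz)) i∈W₁ yu
      ; (inj₂ (y , inj₂ (j , y≡w , j∈W₂) , yu)) → W₁-closed y i (inj₁ (j , y≡w , j∈W₂)) i∈W₁ yu }

    ext : StableExtension D Forced W₁ (allFin n)
    ext = extendStable D Forced forced? (allFin n) W₁ W₁-Stable W₁-unforced

    open StableExtension ext

    C : Fin n → Bool
    C x = not (S x)

    ∈S⇒∉C : ∀ {x} → T (S x) → C x ≡ false
    ∈S⇒∉C {x} x∈S with S x
    ... | true = refl

    ∉C⇒∈S : ∀ {x} → C x ≡ false → T (S x)
    ∉C⇒∈S {x} x∉C with S x
    ... | true = _
    ... | false = subst T x∉C _

    cover : VertexCover C
    cover x y xy with T? (S x) | T? (S y)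
    ... | no x∉S | _ = T-∨ˡ (T-not⁺ x∉S)
    ... | yes _ | no y∉S = T-∨ʳ (T-not⁺ y∉S)
    ... | yes x∈S | yes y∈S = ⊥-elim (stable x y x∈S y∈S xy)

    K⊆C : ∀ x → T (V K x) → T (C x)
    K⊆C x x∈K = T-not⁺ (λ x∈S → avoids x x∈S (inj₁ x∈K))

    ¬L₃-unforced : ∀ x → L₃ C x → ¬ Forced x → ⊥
    ¬L₃-unforced x (x∈C , ¬L₁ , ¬L₂) unforced with saturated x (∈-allFin x) unforced
    ... | inj₁ x∈S = T-not⁻ x∈C x∈S
    ... | inj₂ (y , y∈S , xy) with T-∨⁻ {E x y} xy
    ...   | inj₁ x→y = ¬L₁ (x∈C , y , x→y , ∈S⇒∉C y∈S)
    ...   | inj₂ y→x = ¬L₂ (x∈C , ¬L₁ , y , y→x , ∈S⇒∉C y∈S)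

    L₃-fedByTail : ∀ x → L₃ C x → FedByTail x →
      Σ (Fin n) λ y → T (E y x) × T (C y) × ¬ L₁ C y × w y > 1
    L₃-fedByTail x (x∈C , ¬L₁ , ¬L₂) (y , tail , y→x) = y , y→x , y∈C , ¬L₁-y , heavy tail
      where
      y∈C : T (C y)
      y∈C = T-not⁺ λ y∈S → ¬L₂ (x∈C , ¬L₁ , y , y→x , ∈S⇒∉C y∈S)
      ¬L₁-y : ¬ L₁ C y
      ¬L₁-y (_ , z , y→z , z∉C) = avoids z (∉C⇒∈S z∉C) (inj₂ (y , tail , y→z))
      heavy : Tail y → w y > 1
      heavy (inj₁ (z , yz)) = tail-heavy y z yz
      heavy (inj₂ (i , refl , i∈W₂)) = W₂-heavy i i∈W₂

    -- A vertex of K not fed by a tail has no in-arc in H, so it is a root vᵢ; then wᵢ ∉ W₂, so wᵢ ∈ W₁ ⊆ S.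
    ¬L₃-root : ∀ x → L₃ C x → T (V K x) → ¬ FedByTail x → ⊥
    ¬L₃-root x (x∈C , ¬L₁ , ¬L₂) x∈K unfed with any? (λ z → T? (Ed H z x))
    ... | yes (z , zx) = unfed (z , inj₁ (x , zx) , proj₁ (isSub-H z x zx))
    ... | no no-in-arc with without-in-arc⇒root x (subst T (sym (V-H≡V-K x)) x∈K) (λ z zx → no-in-arc (z , zx))
    ...   | i , refl with inW₂ (wᵥ i) in W₂?
    ...     | true = unfed (wᵥ i , inj₂ (i , refl , subst T (sym W₂?) _) , W₂-arc i (subst T (sym W₂?) _))
    ...     | false with T-∨⁻ {E (wᵥ i) (v i)} (W-adj i)
    ...       | inj₁ w→v = ¬L₂ (x∈C , ¬L₁ , wᵥ i , w→v , ∈S⇒∉C (S₀⊆S (wᵥ i) (fromWitness (i , refl , W₂?))))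
    ...       | inj₂ v→w = ¬L₁ (x∈C , wᵥ i , v→w , ∈S⇒∉C (S₀⊆S (wᵥ i) (fromWitness (i , refl , W₂?))))

    strong : ∀ x → L₃ C x → Σ (Fin n) λ y → T (E y x) × T (C y) × ¬ L₁ C y × w y > 1
    strong x x∈L₃ with forced? x
    ... | no unforced = ⊥-elim (¬L₃-unforced x x∈L₃ unforced)
    ... | yes _ with fedByTail? x
    ...   | yes fed = L₃-fedByTail x x∈L₃ fed
    strong x x∈L₃ | yes (inj₁ x∈K) | no unfed = ⊥-elim (¬L₃-root x x∈L₃ x∈K unfed)
    strong x x∈L₃ | yes (inj₂ fed) | no unfed = ⊥-elim (unfed fed)

    strongCover : Σ (Fin n → Bool) λ C → StrongVC C × (∀ x → T (V K x) → T (C x))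
    strongCover = C , (cover , strong) , K⊆C

  semiForest⇒strongCover : (K : Sub n) →
    (Σ (Sub n) λ H → StarSemiForest H × (∀ x → V H x ≡ V K x)) →
    Σ (Fin n → Bool) λ C → StrongVC C × (∀ x → T (V K x) → T (C x))
  semiForest⇒strongCover K (H , (isSub-H , _ , _ , Tr , v , B , rot , uni , V-H , Ed-H , _ , _ , _ ,
                                 wᵥ , inW₂ , W∉H , W-adj , W₁-stable , W₂-heavy , W₂-arc , W₁-closed) , V-H≡V-K) =
    FromSemiForest.strongCover K H V-H≡V-K isSub-H Tr v B rot uni (proj₁ ∘ V-H) Ed-H
      wᵥ inW₂ W∉H W-adj W₁-stable W₂-heavy W₂-arc W₁-closed

-- From a strong vertex cover to a ⋆-semi-forest

module _ (D : WOG) where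
  open WOG D
  open WithD D

  module ParentGraph (K : Fin n → Bool) (hasParent : Fin n → Bool) (parent : Fin n → Fin n)
    (parent-root : ∀ x → ¬ T (hasParent x) → parent x ≡ x)
    (parent-arc : ∀ x → T (hasParent x) → T (E (parent x) x))
    (parent-K : ∀ x → T (hasParent x) → T (K (parent x)))
    (parent-heavy : ∀ x → T (hasParent x) → w (parent x) > 1) where

    open ParentMap n parent public

    Child : Fin n → Fin n → Set
    Child y x = T (hasParent y) × parent y ≡ x

    parent≢ : ∀ x → T (hasParent x) → parent x ≢ x
    parent≢ x h e = subst T (irrefl x) (subst (λ q → T (E q x)) e (parent-arc x h))

    light⇒childless : ∀ x → w x ≡ 1 → ∀ y → ¬ Child y x
    light⇒childless x w≡1 y (h , refl) = ℕ.<-irrefl (sym w≡1) (parent-heavy y h)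

    aperiodic⇒hasParent : ∀ z → ¬ Periodic z → T (hasParent z)
    aperiodic⇒hasParent z aperiodic with T? (hasParent z)
    ... | yes h = h
    ... | no ¬h = ⊥-elim (aperiodic (fixed⇒Periodic z (parent-root z ¬h)))

    Periodic-child-injective : ∀ y y′ → Periodic y → Periodic y′ → parent y ≡ parent y′ → y ≡ y′
    Periodic-child-injective y y′ (k , e) (k′ , e′) same = begin
      y                   ≡⟨ sym (iter-* p (suc (toℕ k′)) y e) ⟩
      iter (p′ * p) y     ≡⟨ cong (flip iter y) (ℕ.*-comm (suc (toℕ k′)) p) ⟩
      iter (suc (toℕ k′ + toℕ k * p′)) y ≡⟨ cong (iter (toℕ k′ + toℕ k * p′)) same ⟩
      iter (p * p′) y′    ≡⟨ iter-* p′ p y′ e′ ⟩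
      y′                  ∎
      where
      open ≡-Reasoning
      p p′ : ℕ
      p = suc (toℕ k)
      p′ = suc (toℕ k′)

    K-parent : ∀ x → T (K x) → T (K (parent x))
    K-parent x x∈K with T? (hasParent x)
    ... | yes h = parent-K x h
    ... | no ¬h = subst (T ∘ K) (sym (parent-root x ¬h)) x∈K

    K-iter : ∀ i x → T (K x) → T (K (iter i x))
    K-iter zero x x∈K = x∈K
    K-iter (suc i) x x∈K = K-iter i (parent x) (K-parent x x∈K)

    parentArc : Fin n → Fin n → Bool
    parentArc a b = hasParent b ∧ isYes (parent b ≟ᶠ a)

    inPiece : Fin n → Fin n → Bool
    inPiece c x = K x ∧ isYes (key x ≟ᶠ c)

    piece : Fin n → Sub n
    piece c = record { V = inPiece c ; Ed = λ a b → parentArc a b ∧ inPiece c b }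

    inPiece⇒ : ∀ c x → T (inPiece c x) → T (K x) × key x ≡ c
    inPiece⇒ c x t with T-∧⁻ {K x} t
    ... | x∈K , key≡ = x∈K , toWitness key≡

    inPiece⇐ : ∀ c x → T (K x) → key x ≡ c → T (inPiece c x)
    inPiece⇐ c x x∈K key≡ = T-∧⁺ {K x} x∈K (fromWitness key≡)

    inPiece-iter : ∀ c i x → T (inPiece c x) → T (inPiece c (iter i x))
    inPiece-iter c i x t with inPiece⇒ c x t
    ... | x∈K , key≡ = inPiece⇐ c (iter i x) (K-iter i x x∈K) (trans (key-iter i x) key≡)

    parentArc⇒ : ∀ a b → T (parentArc a b) → Child b a
    parentArc⇒ a b t = let h , same = T-∧⁻ {hasParent b} t in h , toWitness same

    parentArc⇐ : ∀ a b → Child b a → T (parentArc a b)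
    parentArc⇐ a b (h , same) = T-∧⁺ {hasParent b} h (fromWitness same)

    pieceArc⇒ : ∀ c a b → T (Ed (piece c) a b) → Child b a × T (inPiece c b)
    pieceArc⇒ c a b t = let ab , b∈ = T-∧⁻ {parentArc a b} t in parentArc⇒ a b ab , b∈

    pieceArc⇐ : ∀ c a b → Child b a → T (inPiece c b) → T (Ed (piece c) a b)
    pieceArc⇐ c a b child b∈ = T-∧⁺ {parentArc a b} (parentArc⇐ a b child) b∈

    piece-IsSub : ∀ c → IsSub (piece c)
    piece-IsSub c a b t with pieceArc⇒ c a b t
    ... | (h , refl) , b∈ = parent-arc b h , inPiece-iter c 1 b b∈ , b∈

    pieceAdj⇒ : ∀ c x y → T (adj (piece c) x y) → Child y x ⊎ Child x y
    pieceAdj⇒ c x y t with T-∨⁻ {Ed (piece c) x y} t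
    ... | inj₁ xy = inj₁ (proj₁ (pieceArc⇒ c x y xy))
    ... | inj₂ yx = inj₂ (proj₁ (pieceArc⇒ c y x yx))

    pieceAdj-inPiece : ∀ c x y → T (adj (piece c) x y) → T (inPiece c x)
    pieceAdj-inPiece c x y t with T-∨⁻ {Ed (piece c) x y} t
    ... | inj₁ xy = proj₁ (proj₂ (piece-IsSub c x y xy))
    ... | inj₂ yx = proj₂ (proj₂ (piece-IsSub c y x yx))

    Periodic-inPiece⇒Orbit : ∀ c z → T (inPiece c z) → Periodic z → Orbit c z
    Periodic-inPiece⇒Orbit c z t pz = subst (λ q → Orbit q z) (proj₂ (inPiece⇒ c z t)) (Orbit-key z pz)

    path-from-cycle : ∀ c x → T (inPiece c x) → OPath (piece c) (iter (depth x) x) x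
    path-from-cycle c x t =
      trajectory (depth x) x , trajectory-Unique-transient x , arcs , trajectory-last (depth x) x
      where
      arcs : Linked (λ a b → T (Ed (piece c) a b)) (trajectory (suc (depth x)) x)
      arcs = trajectory-Linked (suc (depth x)) x λ i i< →
        pieceArc⇐ c (iter (suc i) x) (iter i x)
          (aperiodic⇒hasParent (iter i x) (depth-minimal x i (ℕ.≤-pred i<)) , sym (iter-par i x))
          (inPiece-iter c i x t)

    deg≡1 : ∀ c x → T (inPiece c x) → T (hasParent x) → (∀ y → ¬ Child y x) → deg (piece c) x ≡ 1
    deg≡1 c x x∈ h childless = ℕ.≤-antisym
      (∣tabulate∣≤1 (adj (piece c) x) λ y z ty tz → trans (sym (neighbour-is-parent y ty)) (neighbour-is-parent z tz))
      (1≤∣tabulate∣ (adj (piece c) x) (parent x) (T-∨ʳ {Ed (piece c) x (parent x)} (pieceArc⇐ c (parent x) x (h , refl) x∈)))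
      where
      neighbour-is-parent : ∀ y → T (adj (piece c) x y) → parent x ≡ y
      neighbour-is-parent y t with pieceAdj⇒ c x y t
      ... | inj₁ y-child = ⊥-elim (childless y y-child)
      ... | inj₂ (_ , same) = same

    module OnUndirectedCycle (c : Fin n) (zs : List (Fin n)) (ucyc : UCycle (piece c) zs) where

      unique : Unique zs
      unique = proj₁ ucyc

      3≤len : 3 ≤ length zs
      3≤len = proj₁ (proj₂ ucyc)

      linked : Linked (λ x y → T (adj (piece c) x y)) zs
      linked = proj₁ (proj₂ (proj₂ ucyc))

      closing : ClosingArc (λ x y → T (adj (piece c) x y)) zs
      closing = proj₂ (proj₂ (proj₂ ucyc))

      cycEdge⇒adj : ∀ x q → cycEdge zs x q → T (adj (piece c) x q)
      cycEdge⇒adj x q e with cycEdge-Linked zs x q linked closing e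
      ... | inj₁ xq = xq
      ... | inj₂ qx = adj-sym (piece c) q x qx

      on-cycle⇒inPiece : ∀ x → x ∈ zs → T (inPiece c x)
      on-cycle⇒inPiece x x∈ with cycEdge-neighbours zs x unique 3≤len x∈
      ... | l , _ , _ , el , _ = pieceAdj-inPiece c x l (cycEdge⇒adj x l el)

      -- x has two distinct neighbours on the cycle and only one parent, so one of them is a child of x.
      child-on-cycle : ∀ x → x ∈ zs → Σ (Fin n) λ y → y ∈ zs × Child y x
      child-on-cycle x x∈ with cycEdge-neighbours zs x unique 3≤len x∈
      ... | l , r , l≢r , el , er with pieceAdj⇒ c x l (cycEdge⇒adj x l el) | pieceAdj⇒ c x r (cycEdge⇒adj x r er)
      ...   | inj₁ l-child | _ = l , cycEdge-∈ʳ zs x l el , l-child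
      ...   | inj₂ _ | inj₁ r-child = r , cycEdge-∈ʳ zs x r er , r-child
      ...   | inj₂ (_ , x→l) | inj₂ (_ , x→r) = ⊥-elim (l≢r (trans (sym x→l) x→r))

      -- A deepest aperiodic vertex of the cycle would have a child on the cycle that is deeper still.
      on-cycle⇒Periodic : ∀ x → x ∈ zs → Periodic x
      on-cycle⇒Periodic x x∈ with periodic? x
      ... | yes px = px
      ... | no ¬px with argmax-all depth {P = λ z → z ∈ zs × ¬ Periodic z} (x∈ , ¬px)
                         (All.tabulate (∈-filter⁻ (¬? ∘ periodic?)))
      ...   | deepest∈ , ¬p-deepest with child-on-cycle _ deepest∈
      ...     | y , y∈ , _ , y→deepest = ⊥-elim (ℕ.<-irrefl refl (subst (_≤ depth deepest) y-deeper y-not-deeper))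
        where
        aperiodic : List (Fin n)
        aperiodic = filter (¬? ∘ periodic?) zs
        deepest : Fin n
        deepest = argmax depth x aperiodic
        ¬py : ¬ Periodic y
        ¬py py = ¬p-deepest (subst Periodic y→deepest (Periodic-par y py))
        y-deeper : depth y ≡ suc (depth deepest)
        y-deeper = trans (depth-par y ¬py) (cong (λ q → suc (depth q)) y→deepest)
        y-not-deeper : depth y ≤ depth deepest
        y-not-deeper = All.lookup (f[xs]≤f[argmax] {f = depth} x aperiodic) (∈-filter⁺ (¬? ∘ periodic?) y∈ ¬py)

    module RootedAt (ρ : Fin n) (ρ∈K : T (K ρ)) (ρ-root : ¬ T (hasParent ρ)) where

      ρ-fixed : parent ρ ≡ ρ
      ρ-fixed = parent-root ρ ρ-root

      ρ∈piece : T (inPiece ρ ρ)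
      ρ∈piece = inPiece⇐ ρ ρ ρ∈K (key-fixed ρ ρ-fixed)

      Periodic⇒ρ : ∀ z → T (inPiece ρ z) → Periodic z → z ≡ ρ
      Periodic⇒ρ z z∈ pz = let i , e = Periodic-inPiece⇒Orbit ρ z z∈ pz in trans (sym e) (iter-fixed (toℕ i) ρ ρ-fixed)

      -- Every vertex of a cycle would be periodic, hence ρ, while some vertex of it has a child on it.
      acyclic : ∀ zs → ¬ UCycle (piece ρ) zs
      acyclic [] (_ , () , _)
      acyclic (x ∷ zs) cyc =
        let y , y∈ , h , y→x = child-on-cycle x (here refl)
        in parent≢ y h (trans y→x (trans (is-ρ x (here refl)) (sym (is-ρ y y∈))))
        where
        open OnUndirectedCycle ρ (x ∷ zs) cyc
        is-ρ : ∀ z → z ∈ x ∷ zs → z ≡ ρ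
        is-ρ z z∈ = Periodic⇒ρ z (on-cycle⇒inPiece z z∈) (on-cycle⇒Periodic z z∈)

      path-from-ρ : ∀ x → T (inPiece ρ x) → OPath (piece ρ) ρ x
      path-from-ρ x x∈ = subst (λ a → OPath (piece ρ) a x)
        (Periodic⇒ρ _ (inPiece-iter ρ (depth x) x x∈) (depth-reaches x)) (path-from-cycle ρ x x∈)

      only-ρ-if-light : w ρ ≡ 1 → ∀ y → T (inPiece ρ y) → y ≡ ρ
      only-ρ-if-light w≡1 y y∈ with y ≟ᶠ ρ
      ... | yes y≡ρ = y≡ρ
      ... | no y≢ρ = let z , ρz = OPath-first-arc (piece ρ) ρ y (path-from-ρ y y∈) (y≢ρ ∘ sym)
                     in ⊥-elim (light⇒childless ρ w≡1 z (proj₁ (pieceArc⇒ ρ ρ z ρz)))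

      rot : ROT (piece ρ) ρ
      rot = piece-IsSub ρ , ρ∈piece , acyclic , (λ x x∈ _ → path-from-ρ x x∈) , light
        where
        light : ∀ x → T (inPiece ρ x) → w x ≡ 1 →
          (deg (piece ρ) x ≡ 1 × x ≢ ρ) ⊎ ((∀ y → T (inPiece ρ y) → y ≡ ρ) × x ≡ ρ)
        light x x∈ w≡1 with x ≟ᶠ ρ
        ... | yes refl = inj₂ (only-ρ-if-light w≡1 , refl)
        ... | no x≢ρ = inj₁ (deg≡1 ρ x x∈ (aperiodic⇒hasParent x (x≢ρ ∘ Periodic⇒ρ x x∈)) (light⇒childless x w≡1) , x≢ρ)

    module CycleAt (c : Fin n) (c∈K : T (K c)) (c-hasParent : T (hasParent c)) (pc : Periodic c) (key≡c : key c ≡ c) where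

      minimalPeriod : Σ (Fin n) λ k → iter (suc (toℕ k)) c ≡ c × (∀ k′ → iter (suc (toℕ k′)) c ≡ c → toℕ k ≤ toℕ k′)
      minimalPeriod = Fin-least (λ k → iter (suc (toℕ k)) c ≡ c) (λ k → iter (suc (toℕ k)) c ≟ᶠ c) pc

      k : Fin n
      k = proj₁ minimalPeriod

      p : ℕ
      p = suc (toℕ k)

      period : iter p c ≡ c
      period = proj₁ (proj₂ minimalPeriod)

      cycle : List (Fin n)
      cycle = trajectory p c

      c∈piece : T (inPiece c c)
      c∈piece = inPiece⇐ c c c∈K key≡c

      Orbit⇒hasParent : ∀ z → Orbit c z → T (hasParent z)
      Orbit⇒hasParent z oz with T? (hasParent z)
      ... | yes h = h
      ... | no ¬h = ⊥-elim (parent≢ c c-hasParent (subst (λ q → parent q ≡ q) z≡c (parent-root z ¬h)))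
        where
        z≡c : z ≡ c
        z≡c = let j , e = Orbit-sym c pc z oz in trans (sym (iter-fixed (toℕ j) z (parent-root z ¬h))) e

      cycle⇒Orbit : ∀ y → y ∈ cycle → Orbit c y
      cycle⇒Orbit y y∈ with ∈-applyDownFrom⁻ (flip iter c) y∈
      ... | i , _ , refl = Orbit-iter c pc i

      Orbit⇒cycle : ∀ y → Orbit c y → y ∈ cycle
      Orbit⇒cycle y (j , e) = subst (_∈ cycle) (trans (sym (iter-% p (toℕ j) c period)) e)
                                (∈-applyDownFrom⁺ (flip iter c) (m%n<n (toℕ j) p))

      parent-last : parent (iter (toℕ k) c) ≡ c
      parent-last = trans (sym (iter-par (toℕ k) c)) period

      cycle-OCycle : OCycle (piece c) cycle
      cycle-OCycle = trajectory-Unique-cycle c k period (proj₂ (proj₂ minimalPeriod))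
                   , trajectory-Linked p c (λ i _ → arc (iter i c) (Orbit-iter c pc i) (sym (iter-par i c)))
                   , iter (toℕ k) c , c , refl , trajectory-last (toℕ k) c , arc _ (Orbit-iter c pc (toℕ k)) parent-last
        where
        arc : ∀ b → Orbit c b → ∀ {a} → parent b ≡ a → T (Ed (piece c) a b)
        arc b ob b→a = pieceArc⇐ c _ b (Orbit⇒hasParent b ob , b→a) (subst (T ∘ inPiece c) (proj₂ ob) (inPiece-iter c (toℕ (proj₁ ob)) c c∈piece))

      cycle-edge : ∀ b → b ∈ cycle → cycEdge cycle (parent b) b
      cycle-edge b b∈ with ∈-applyDownFrom⁻ (flip iter c) b∈
      ... | i , i<p , refl with i ℕ.≟ toℕ k
      ...   | yes refl = inj₁ (inj₂ (trans (trajectory-last (toℕ k) c) (cong just (sym parent-last)) , refl))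
      ...   | no i≢k = inj₁ (inj₁ (subst (λ q → consec cycle q (iter i c)) (iter-par i c)
                                         (trajectory-consec p c i (ℕ.≤∧≢⇒< i<p (i≢k ∘ ℕ.suc-injective)))))

      module Against (zs : List (Fin n)) (ucyc : UCycle (piece c) zs) where
        open OnUndirectedCycle c zs ucyc

        zs⊆cycle : ∀ x → x ∈ zs → x ∈ cycle
        zs⊆cycle x x∈ = Orbit⇒cycle x (Periodic-inPiece⇒Orbit c x (on-cycle⇒inPiece x x∈) (on-cycle⇒Periodic x x∈))

        -- The two cycle-neighbours of x are periodic, so they cannot both be children of x.
        parent-on-cycle : ∀ x → x ∈ zs → cycEdge zs x (parent x)
        parent-on-cycle x x∈ =
          let l , r , l≢r , el , er = cycEdge-neighbours zs x unique 3≤len x∈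
          in choose l r l≢r el er (pieceAdj⇒ c x l (cycEdge⇒adj x l el)) (pieceAdj⇒ c x r (cycEdge⇒adj x r er))
          where
          choose : ∀ l r → l ≢ r → cycEdge zs x l → cycEdge zs x r →
                   Child l x ⊎ Child x l → Child r x ⊎ Child x r → cycEdge zs x (parent x)
          choose l r _ el _ (inj₂ (_ , x→l)) _ = subst (cycEdge zs x) (sym x→l) el
          choose l r _ _ er (inj₁ _) (inj₂ (_ , x→r)) = subst (cycEdge zs x) (sym x→r) er
          choose l r l≢r el er (inj₁ (_ , l→x)) (inj₁ (_ , r→x)) = ⊥-elim (l≢r (Periodic-child-injective l r
            (on-cycle⇒Periodic l (cycEdge-∈ʳ zs x l el)) (on-cycle⇒Periodic r (cycEdge-∈ʳ zs x r er)) (trans l→x (sym r→x))))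

        iter-on-cycle : ∀ j x → x ∈ zs → iter j x ∈ zs
        iter-on-cycle zero x x∈ = x∈
        iter-on-cycle (suc j) x x∈ = iter-on-cycle j (parent x) (cycEdge-∈ʳ zs x (parent x) (parent-on-cycle x x∈))

        cycle⊆zs : ∀ y → y ∈ cycle → y ∈ zs
        cycle⊆zs y y∈ =
          let x₀ , _ , head≡x₀ , _ = closing
              x₀∈ = head-∈ zs head≡x₀
              px₀ = on-cycle⇒Periodic x₀ x₀∈
              c⇝x₀ = Periodic-inPiece⇒Orbit c x₀ (on-cycle⇒inPiece x₀ x₀∈) px₀
              j , e = Orbit-trans x₀ px₀ c y (Orbit-sym c pc x₀ c⇝x₀) (cycle⇒Orbit y y∈)
          in subst (_∈ zs) e (iter-on-cycle (toℕ j) x₀ x₀∈)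

        cycEdge⇒ : ∀ a b → cycEdge zs a b → cycEdge cycle a b
        cycEdge⇒ a b e = orient (pieceAdj⇒ c a b (cycEdge⇒adj a b e))
          where
          orient : Child b a ⊎ Child a b → cycEdge cycle a b
          orient (inj₁ (_ , b→a)) = subst (λ q → cycEdge cycle q b) b→a (cycle-edge b (zs⊆cycle b (cycEdge-∈ʳ zs a b e)))
          orient (inj₂ (_ , a→b)) = cycEdge-sym cycle b a
            (subst (λ q → cycEdge cycle q a) a→b (cycle-edge a (zs⊆cycle a (cycEdge-∈ʳ zs b a (cycEdge-sym zs a b e)))))

        cycEdge⇐ : ∀ a b → cycEdge cycle a b → cycEdge zs a b
        cycEdge⇐ a b e = orient (cycEdge-Linked cycle a b (proj₁ (proj₂ cycle-OCycle)) (proj₂ (proj₂ cycle-OCycle)) e)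
          where
          orient : T (Ed (piece c) a b) ⊎ T (Ed (piece c) b a) → cycEdge zs a b
          orient (inj₁ ab) = cycEdge-sym zs b a (subst (cycEdge zs b) (proj₂ (proj₁ (pieceArc⇒ c a b ab)))
                               (parent-on-cycle b (cycle⊆zs b (cycEdge-∈ʳ cycle a b e))))
          orient (inj₂ ba) = subst (cycEdge zs a) (proj₂ (proj₁ (pieceArc⇒ c b a ba)))
                               (parent-on-cycle a (cycle⊆zs a (cycEdge-∈ʳ cycle b a (cycEdge-sym cycle a b e))))

      inPiece⇒hasParent : ∀ x → T (inPiece c x) → T (hasParent x)
      inPiece⇒hasParent x x∈ with periodic? x
      ... | yes px = Orbit⇒hasParent x (Periodic-inPiece⇒Orbit c x x∈ px)
      ... | no ¬px = aperiodic⇒hasParent x ¬px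

      unicycle : Unicycle (piece c)
      unicycle = piece-IsSub c , cycle , cycle-OCycle , only-cycle , paths , light
        where
        only-cycle : ∀ zs → UCycle (piece c) zs → ∀ a b → cycEdge zs a b ↔ cycEdge cycle a b
        only-cycle zs ucyc a b = Against.cycEdge⇒ zs ucyc a b , Against.cycEdge⇐ zs ucyc a b
        paths : ∀ y → T (inPiece c y) → y ∉ cycle → Σ (Fin n) λ c′ → c′ ∈ cycle × OPath (piece c) c′ y
        paths y y∈ _ = iter (depth y) y
                     , Orbit⇒cycle _ (Periodic-inPiece⇒Orbit c _ (inPiece-iter c (depth y) y y∈) (depth-reaches y))
                     , path-from-cycle c y y∈
        light : ∀ x → T (inPiece c x) → w x ≡ 1 → deg (piece c) x ≡ 1
        light x x∈ w≡1 = deg≡1 c x x∈ (inPiece⇒hasParent x x∈) (light⇒childless x w≡1)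

  module FromStrongCover (K : Sub n) (C : Fin n → Bool) (C-strong : StrongVC C)
    (K⊆C : ∀ x → T (V K x) → T (C x)) where

    l₁? : ∀ y → Dec (L₁ C y)
    l₁? y = T? (C y) ×-dec any? (λ z → T? (E y z) ×-dec (C z ≟ᵇ false))

    Candidate : Fin n → Fin n → Set
    Candidate x y = T (V K x) × T (E y x) × T (C y) × ¬ L₁ C y × w y > 1 × T (V K y)

    candidate? : ∀ x y → Dec (Candidate x y)
    candidate? x y = T? (V K x) ×-dec T? (E y x) ×-dec T? (C y) ×-dec ¬? (l₁? y) ×-dec (1 ℕ.<? w y) ×-dec T? (V K y)

    choice : ∀ x → Dec (Σ (Fin n) (Candidate x))
    choice x = any? (candidate? x)

    hasParent : Fin n → Bool
    hasParent x = isYes (choice x)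

    parent : Fin n → Fin n
    parent x with choice x
    ... | yes (y , _) = y
    ... | no _ = x

    parent-Candidate : ∀ x → T (hasParent x) → Candidate x (parent x)
    parent-Candidate x h with choice x
    ... | yes (_ , candidate) = candidate

    parent-root : ∀ x → ¬ T (hasParent x) → parent x ≡ x
    parent-root x ¬h with choice x
    ... | yes _ = ⊥-elim (¬h _)
    ... | no _ = refl

    parent-arc : ∀ x → T (hasParent x) → T (E (parent x) x)
    parent-arc x h = let _ , yx , _ = parent-Candidate x h in yx

    parent-K : ∀ x → T (hasParent x) → T (V K (parent x))
    parent-K x h = let _ , _ , _ , _ , _ , y∈K = parent-Candidate x h in y∈K

    parent-heavy : ∀ x → T (hasParent x) → w (parent x) > 1
    parent-heavy x h = let _ , _ , _ , _ , heavy , _ = parent-Candidate x h in heavy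

    open ParentGraph (V K) hasParent parent parent-root parent-arc parent-K parent-heavy

    parent-¬L₁ : ∀ a y → Child y a → ¬ L₁ C a
    parent-¬L₁ a y (h , refl) = let _ , _ , _ , ¬L₁ , _ = parent-Candidate y h in ¬L₁

    IsRoot : Fin n → Set
    IsRoot x = T (V K x) × ¬ T (hasParent x)

    root? : ∀ x → Dec (IsRoot x)
    root? x = T? (V K x) ×-dec ¬? (T? (hasParent x))

    IsCycleKey : Fin n → Set
    IsCycleKey x = T (V K x) × T (hasParent x) × Periodic x × key x ≡ x

    cycleKey? : ∀ x → Dec (IsCycleKey x)
    cycleKey? x = T? (V K x) ×-dec T? (hasParent x) ×-dec periodic? x ×-dec (key x ≟ᶠ x)

    roots cycleKeys : List (Fin n)
    roots = filter root? (allFin n)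
    cycleKeys = filter cycleKey? (allFin n)

    r s : ℕ
    r = length roots
    s = length cycleKeys

    v : Fin r → Fin n
    v = lookup roots

    κ : Fin s → Fin n
    κ = lookup cycleKeys

    v-IsRoot : ∀ i → IsRoot (v i)
    v-IsRoot i = proj₂ (∈-filter⁻ root? {xs = allFin n} (∈-lookup i))

    κ-IsCycleKey : ∀ j → IsCycleKey (κ j)
    κ-IsCycleKey j = proj₂ (∈-filter⁻ cycleKey? {xs = allFin n} (∈-lookup j))

    Tr : Fin r → Sub n
    Tr i = piece (v i)

    B : Fin s → Sub n
    B j = piece (κ j)

    H : Sub n
    H = record { V = V K ; Ed = parentArc }

    H-IsSub : IsSub H
    H-IsSub a b ab with parentArc⇒ a b ab
    ... | h , refl = let b∈K , a→b , _ , _ , _ , a∈K = parent-Candidate b h in a→b , a∈K , b∈K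

    K-key : ∀ x → T (V K x) → T (V K (key x))
    K-key x x∈K = let i , e = key-Orbit x in subst (T ∘ V K) e (K-iter (toℕ i) (iter n x) (K-iter n x x∈K))

    key-classified : ∀ x → T (V K x) → IsRoot (key x) ⊎ IsCycleKey (key x)
    key-classified x x∈K with T? (hasParent (key x))
    ... | no ¬h = inj₁ (K-key x x∈K , ¬h)
    ... | yes h = inj₂ (K-key x x∈K , h , Periodic-key x , key-idem x)

    InSomePiece : Fin n → Set
    InSomePiece x = (Σ (Fin r) λ i → T (V (Tr i) x)) ⊎ (Σ (Fin s) λ j → T (V (B j) x))

    V-H⇒ : ∀ x → T (V K x) → InSomePiece x
    V-H⇒ x x∈K = place (key-classified x x∈K)
      where
      place : IsRoot (key x) ⊎ IsCycleKey (key x) → InSomePiece x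
      place (inj₁ root) = let i , e = position roots (key x) (∈-filter⁺ root? (∈-allFin _) root)
                          in inj₁ (i , inPiece⇐ (v i) x x∈K (sym e))
      place (inj₂ cyc) = let j , e = position cycleKeys (key x) (∈-filter⁺ cycleKey? (∈-allFin _) cyc)
                         in inj₂ (j , inPiece⇐ (κ j) x x∈K (sym e))

    V-H⇐ : ∀ x → InSomePiece x → T (V K x)
    V-H⇐ x (inj₁ (i , x∈)) = proj₁ (inPiece⇒ (v i) x x∈)
    V-H⇐ x (inj₂ (j , x∈)) = proj₁ (inPiece⇒ (κ j) x x∈)

    Ed-H⇒ : ∀ a b → T (parentArc a b) → InSomePiece b →
      (Σ (Fin r) λ i → T (Ed (Tr i) a b)) ⊎ (Σ (Fin s) λ j → T (Ed (B j) a b))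
    Ed-H⇒ a b ab (inj₁ (i , b∈)) = inj₁ (i , T-∧⁺ {parentArc a b} ab b∈)
    Ed-H⇒ a b ab (inj₂ (j , b∈)) = inj₂ (j , T-∧⁺ {parentArc a b} ab b∈)

    Ed-H⇐ : ∀ a b → (Σ (Fin r) λ i → T (Ed (Tr i) a b)) ⊎ (Σ (Fin s) λ j → T (Ed (B j) a b)) → T (parentArc a b)
    Ed-H⇐ a b (inj₁ (i , ab)) = proj₁ (T-∧⁻ {parentArc a b} ab)
    Ed-H⇐ a b (inj₂ (j , ab)) = proj₁ (T-∧⁻ {parentArc a b} ab)

    Tr-disjoint : ∀ i i′ x → T (V (Tr i) x) → T (V (Tr i′) x) → i ≡ i′
    Tr-disjoint i i′ x x∈ x∈′ = Unique-lookup-injective roots (Unique.filter⁺ root? (Unique.allFin⁺ n)) i i′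
      (trans (sym (proj₂ (inPiece⇒ _ x x∈))) (proj₂ (inPiece⇒ _ x x∈′)))

    B-disjoint : ∀ j j′ x → T (V (B j) x) → T (V (B j′) x) → j ≡ j′
    B-disjoint j j′ x x∈ x∈′ = Unique-lookup-injective cycleKeys (Unique.filter⁺ cycleKey? (Unique.allFin⁺ n)) j j′
      (trans (sym (proj₂ (inPiece⇒ _ x x∈))) (proj₂ (inPiece⇒ _ x x∈′)))

    Tr-B-disjoint : ∀ i j x → T (V (Tr i) x) → ¬ T (V (B j) x)
    Tr-B-disjoint i j x x∈T x∈B = proj₂ (v-IsRoot i)
      (subst (T ∘ hasParent) (trans (sym (proj₂ (inPiece⇒ _ x x∈B))) (proj₂ (inPiece⇒ _ x x∈T))) (proj₁ (proj₂ (κ-IsCycleKey j))))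

    -- A root ρ lies in C; if it is in L₁ or L₂ it has a neighbour outside C (its w lands in W₁),
    -- otherwise it is in L₃ and strongness provides an in-neighbour (its w lands in W₂ = W ∩ C).
    Witness : Fin n → Set
    Witness ρ = Σ (Fin n) λ y → (((T (E ρ y) ⊎ T (E y ρ)) × C y ≡ false) ⊎ (T (E y ρ) × T (C y) × ¬ L₁ C y × w y > 1))

    witness : ∀ ρ → IsRoot ρ → Witness ρ
    witness ρ (ρ∈K , _) with l₁? ρ
    ... | yes (_ , y , ρy , y∉C) = y , inj₁ (inj₁ ρy , y∉C)
    ... | no ¬L₁ with any? (λ y → T? (E y ρ) ×-dec (C y ≟ᵇ false))
    ...   | yes (y , yρ , y∉C) = y , inj₁ (inj₂ yρ , y∉C)
    ...   | no ¬L₂ = let y , yρ , y∈C , y-¬L₁ , heavy = proj₂ C-strong ρ (K⊆C ρ ρ∈K , ¬L₁ , λ l₂ → ¬L₂ (proj₂ (proj₂ l₂)))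
                     in y , inj₂ (yρ , y∈C , y-¬L₁ , heavy)

    wᵥ : Fin r → Fin n
    wᵥ i = proj₁ (witness (v i) (v-IsRoot i))

    witness-∉K : ∀ ρ → IsRoot ρ → (d : Witness ρ) → ¬ T (V K (proj₁ d))
    witness-∉K ρ _ (y , inj₁ (_ , y∉C)) y∈K = subst T y∉C (K⊆C y y∈K)
    witness-∉K ρ (ρ∈K , ¬h) (y , inj₂ (yρ , y∈C , y-¬L₁ , heavy)) y∈K =
      ¬h (fromWitness (y , ρ∈K , yρ , y∈C , y-¬L₁ , heavy , y∈K))

    witness-adj : ∀ ρ (d : Witness ρ) → T (adjD (proj₁ d) ρ)
    witness-adj ρ (y , inj₁ (inj₁ ρy , _)) = T-∨ʳ {E y ρ} ρy
    witness-adj ρ (y , inj₁ (inj₂ yρ , _)) = T-∨ˡ yρ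
    witness-adj ρ (y , inj₂ (yρ , _)) = T-∨ˡ yρ

    covered-witness : ∀ ρ (d : Witness ρ) → T (C (proj₁ d)) → T (E (proj₁ d) ρ) × ¬ L₁ C (proj₁ d) × w (proj₁ d) > 1
    covered-witness ρ (y , inj₁ (_ , y∉C)) y∈C = ⊥-elim (subst T y∉C y∈C)
    covered-witness ρ (y , inj₂ (yρ , _ , y-¬L₁ , heavy)) _ = yρ , y-¬L₁ , heavy

    uncovered-nonadjacent : ∀ a b → C a ≡ false → C b ≡ false → ¬ T (adjD a b)
    uncovered-nonadjacent a b a∉C b∉C ab with T-∨⁻ {E a b} ab
    ... | inj₁ a→b = [ subst T a∉C , subst T b∉C ] (T-∨⁻ {C a} (proj₁ C-strong a b a→b))
    ... | inj₂ b→a = [ subst T b∉C , subst T a∉C ] (T-∨⁻ {C b} (proj₁ C-strong b a b→a))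

    has-child : ∀ a → (2 ≤ deg H a ⊎ (¬ T (hasParent a) × deg H a ≡ 1)) → Σ (Fin n) λ y → Child y a
    has-child a busy with any? (λ y → T? (hasParent y) ×-dec (parent y ≟ᶠ a))
    ... | yes child = child
    ... | no childless = ⊥-elim (idle busy)
      where
      neighbour-is-parent : ∀ y → T (adj H a y) → parent a ≡ y
      neighbour-is-parent y t with T-∨⁻ {parentArc a y} t
      ... | inj₁ ay = ⊥-elim (childless (y , parentArc⇒ a y ay))
      ... | inj₂ ya = proj₂ (parentArc⇒ y a ya)
      isolated : ¬ T (hasParent a) → ∀ y → ¬ T (adj H a y)
      isolated ¬h y t with T-∨⁻ {parentArc a y} t
      ... | inj₁ ay = childless (y , parentArc⇒ a y ay)
      ... | inj₂ ya = ¬h (proj₁ (parentArc⇒ y a ya))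
      idle : ¬ (2 ≤ deg H a ⊎ (¬ T (hasParent a) × deg H a ≡ 1))
      idle (inj₁ 2≤deg) = ℕ.<-irrefl refl (ℕ.≤-trans 2≤deg (∣tabulate∣≤1 (adj H a)
        λ y z ty tz → trans (sym (neighbour-is-parent y ty)) (neighbour-is-parent z tz)))
      idle (inj₂ (¬h , deg≡1)) = ℕ.0≢1+n (trans (sym (∣tabulate∣≡0 (adj H a) (isolated ¬h))) deg≡1)

    W₁-closed : ∀ a i →
      ((Σ (Fin r) λ j → a ≡ wᵥ j × T (C (wᵥ j)))
       ⊎ ((T (V H a) × deg H a ≥ 2) ⊎ (Σ (Fin r) λ j → a ≡ v j × deg H (v j) ≡ 1))) →
      C (wᵥ i) ≡ false → ¬ T (E a (wᵥ i))
    W₁-closed a i (inj₁ (j , refl , w∈C)) w∉C aw =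
      proj₁ (proj₂ (covered-witness (v j) (witness (v j) (v-IsRoot j)) w∈C)) (w∈C , wᵥ i , aw , w∉C)
    W₁-closed a i (inj₂ (inj₁ (a∈K , 2≤deg))) w∉C aw =
      let y , child = has-child a (inj₁ 2≤deg) in parent-¬L₁ a y child (K⊆C a a∈K , wᵥ i , aw , w∉C)
    W₁-closed a i (inj₂ (inj₂ (j , refl , deg≡1))) w∉C aw =
      let ρ∈K , ¬h = v-IsRoot j
          y , child = has-child (v j) (inj₂ (¬h , deg≡1))
      in parent-¬L₁ (v j) y child (K⊆C (v j) ρ∈K , wᵥ i , aw , w∉C)

    rots : ∀ i → ROT (Tr i) (v i)
    rots i = let ρ∈K , ¬h = v-IsRoot i in RootedAt.rot (v i) ρ∈K ¬h

    unicycles : ∀ j → Unicycle (B j)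
    unicycles j = let c∈K , h , pc , key≡c = κ-IsCycleKey j in CycleAt.unicycle (κ j) c∈K h pc key≡c

    semiForest : StarSemiForest H
    semiForest = H-IsSub , r , s , Tr , v , B , rots , unicycles
      , (λ x → V-H⇒ x , V-H⇐ x)
      , (λ a b → (λ ab → Ed-H⇒ a b ab (V-H⇒ b (proj₂ (proj₂ (H-IsSub a b ab))))) , Ed-H⇐ a b)
      , Tr-disjoint , B-disjoint , Tr-B-disjoint
      , wᵥ , C
      , (λ i → witness-∉K (v i) (v-IsRoot i) (witness (v i) (v-IsRoot i)))
      , (λ i → witness-adj (v i) (witness (v i) (v-IsRoot i)))
      , (λ i j → uncovered-nonadjacent (wᵥ i) (wᵥ j))
      , (λ i w∈C → proj₂ (proj₂ (covered-witness (v i) (witness (v i) (v-IsRoot i)) w∈C)))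
      , (λ i w∈C → proj₁ (covered-witness (v i) (witness (v i) (v-IsRoot i)) w∈C))
      , W₁-closed

  strongCover⇒semiForest : (K : Sub n) →
    (Σ (Fin n → Bool) λ C → StrongVC C × (∀ x → T (V K x) → T (C x))) →
    Σ (Sub n) λ H → StarSemiForest H × (∀ x → V H x ≡ V K x)
  strongCover⇒semiForest K (C , C-strong , K⊆C) = H , semiForest , λ _ → refl
    where open FromStrongCover K C C-strong K⊆C

theorem3p10 : (D : WOG) (K : Sub (WOG.n D)) → WithD.Induced D K →
    (Σ (Fin (WOG.n D) → Bool) λ C → WithD.StrongVC D C × (∀ x → T (V K x) → T (C x)))
    ↔ (Σ (Sub (WOG.n D)) λ H → WithD.StarSemiForest D H × (∀ x → V H x ≡ V K x))
theorem3p10 D K _ = strongCover⇒semiForest D K , semiForest⇒strongCover D K
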